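{- Let $g \in \mathbb{N}$ be odd and square-free, written $g = q_1 q_2 \cdots q_r$ with pairwise distinct primes $q_i$ (ordered so that $(g,d) = q_1 \cdots q_s$), let $d \in 2\mathbb{N}$ and $\varepsilon_1, \varepsilon_2 \in \{ -1,1\}$. Then $$|\Phi_{\varepsilon_1,\varepsilon_2}(g,d)| = \frac{1}{4}\left(|\varphi_d(g)| + (-1)^r\left(\left(\tfrac{ -d}{g}\right)\varepsilon_1 + \left(\tfrac{d}{g}\right)\varepsilon_2 + \varepsilon_1\varepsilon_2\right)\right) \quad \text{if } (g,d)=1,$$ and $$|\Phi_{\varepsilon_1,\varepsilon_2}(g,d)| = \frac{1}{4}\left(|\varphi_d(g)| + (-1)^{r-s}\varepsilon_1\varepsilon_2 \prod_{i=1}^{s}(q_i - 1)\right) \quad \text{if } (g,d)\neq 1.$$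
   Context: $\left(\frac{a}{n}\right)$ denotes the Jacobi symbol (for odd positive $n$; in particular $\left(\frac{a}{1}\right)=1$). For $g, d \in \mathbb{N}$, $\varphi_d(g) := \{1 \leq \alpha \leq g : (\alpha, g) = (\alpha + d, g) = 1\}$. For odd square-free $g \in \mathbb{N}$, $d \in 2\mathbb{N}$ and $\varepsilon_1,\varepsilon_2 \in \{ -1,1\}$, $\Phi_{\varepsilon_1,\varepsilon_2}(g,d) := \{1 \leq \alpha \leq g : \left(\frac{\alpha}{g}\right) = \varepsilon_1 \text{ and } \left(\frac{\alpha+d}{g}\right) = \varepsilon_2\}$. -}

module Defs where

open import Data.Nat as ℕ using (ℕ; zero; suc; _∸_)
open import Data.Nat.Divisibility using (_∣_; _∣?_)
open import Data.Nat.Coprimality using (Coprime; coprime?)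
open import Data.Nat.Primality.Factorisation using (factorise; factors)
open import Data.Integer as ℤ using (ℤ; +_; _%ℕ_)
open import Data.List using (List; []; _∷_; foldr; map; filter; length; upTo)
open import Data.List.Relation.Unary.Any using (any?)
open import Data.Product using (∃; _×_; _,_)
open import Relation.Nullary using (does; _×-dec_)
open import Relation.Binary.PropositionalEquality using (_≡_)
open import Data.Bool using (if_then_else_)

-- Legendre symbol (a/p) for a prime p (only meaningful for odd prime p):
--   0 if p ∣ a, 1 if a is a nonzero square mod p, -1 otherwise.
legendre : ℤ → ℕ → ℤ
legendre a zero = + 1
legendre a p@(suc _) =
  if does (a %ℕ p ℕ.≟ 0) then + 0
  else if does (any? (λ x → (x ℕ.* x) ℕ.% p ℕ.≟ a %ℕ p) (upTo p)) then + 1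
  else ℤ.- (+ 1)

-- Jacobi symbol (a/n): product of Legendre symbols over the prime
-- factorisation of n (with multiplicity); (a/1) = 1.
-- Only meaningful for odd positive n (the value at n = 0 is a dummy).
jacobi : ℤ → ℕ → ℤ
jacobi a zero = + 1
jacobi a n@(suc _) = foldr ℤ._*_ (+ 1) (map (legendre a) (factors (factorise n)))

φ-set : ℕ → ℕ → List ℕ
φ-set g d = filter (λ α → coprime? α g ×-dec coprime? (α ℕ.+ d) g)
                   (map suc (upTo g))

Φ-set : ℤ → ℤ → ℕ → ℕ → List ℕ
Φ-set ε₁ ε₂ g d =
  filter (λ α → (jacobi (+ α) g ℤ.≟ ε₁) ×-dec
                (jacobi (+ (α ℕ.+ d)) g ℤ.≟ ε₂))
         (map suc (upTo g))

{-# OPTIONS --safe #-}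
module Submission where

-- For an odd prime q let χ_q be the Legendre symbol mod q, and for α let J = (α/g), J′ = ((α+d)/g).
-- Since J, J′ ∈ {0, ±1}, the indicator of J = ε₁ ∧ J′ = ε₂ is ¼ (J² + ε₁ J)(J′² + ε₂ J′), and J² J′²
-- is the indicator of α ∈ φ_d(g). Expanding and summing over α mod g, the Chinese remainder theorem
-- splits each of the four sums into a product over q ∣ g of the character sums
--   Σ χ(a)² χ(a+d) = −χ(d),   Σ χ(a) χ(a+d)² = −χ(−d),   Σ χ(a) χ(a+d) = −1 or q − 1  (q ∤ d or q ∣ d),
-- where a runs mod q. The last one comes from counting solutions of y² ≡ x² + d, via #{x : x² ≡ a} = 1 + χ(a).

open import Defs
open import Data.Nat as ℕ using (ℕ; _∸_)
open import Data.Nat using (zero; suc; _<_; _≤_; z≤n; s≤s; NonZero; _%_; _/_)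
import Data.Nat.Properties as ℕP
open import Data.Nat.DivMod using (m≡m%n+[m/n]*n; m%n<n; m<n⇒m%n≡m; [m+n]%n≡m%n; [m+kn]%n≡m%n; %-distribˡ-+; n%n≡0)
open import Data.Nat.Divisibility
  using (_∣_; _∣?_; divides; ∣⇒≤; ∣1⇒≡1; ∣-refl; ∣-trans; m∣m*n; n∣m*n; m%n≡0⇒n∣m; n∣m⇒m%n≡0)
open import Data.Nat.Coprimality as Coprime using (Coprime; coprime-divisor; coprime?)
open import Data.Nat.Primality
  using (Prime; prime⇒irreducible; prime⇒nonZero; productOfPrimes≢0; euclidsLemma; prime[2]; ¬prime[1])
open import Data.Nat.Primality.Factorisation using (factorisationHasAllPrimeFactors; factorisationUnique; factorise)
open import Data.Nat.GCD using (gcd; gcd-greatest)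
open import Data.Nat.ListAction using (product)
open import Data.Nat.ListAction.Properties using (∈⇒∣product)
open import Data.Nat.Solver using (module +-*-Solver)
open import Data.Integer as ℤ using (ℤ; +_; -_; _+_; _*_; _^_; _-_)
import Data.Integer.Properties as ℤP
open import Data.Integer.Tactic.RingSolver using (solve-∀)
open import Algebra.Properties.AbelianGroup ℤP.+-0-abelianGroup using (∙-cancelˡ)
open import Data.List using (List; []; _∷_; foldr; map; length; upTo; applyUpTo; filter)
import Data.List.Properties as ListP
open import Data.List.Membership.Propositional using (_∈_; find; lose)
open import Data.List.Membership.Propositional.Properties using (∈-upTo⁺; ∈-upTo⁻)
open import Data.List.Relation.Unary.Any using (Any; here; there; any?)
open import Data.List.Relation.Unary.All as All using (All; []; _∷_)
open import Data.List.Relation.Unary.All.Properties using (¬Any⇒All¬)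
open import Data.List.Relation.Unary.AllPairs using ([]; _∷_)
open import Data.List.Relation.Unary.Unique.Propositional using (Unique)
open import Data.List.Relation.Binary.Permutation.Propositional using (_↭_; ↭⇒↭ₛ)
open import Data.List.Relation.Binary.Permutation.Propositional.Properties using (map⁺)
open import Data.List.Relation.Binary.Permutation.Setoid.Properties using (foldr-commMonoid)
open import Data.Bool using (true; false; if_then_else_)
open import Data.Product using (_×_; _,_)
open import Data.Sum as Sum using (_⊎_; inj₁; inj₂; [_,_]′)
open import Relation.Nullary using (Dec; yes; no; does; ¬_; contradiction; _×-dec_)
open import Relation.Binary.PropositionalEquality
  using (_≡_; _≢_; refl; sym; trans; cong; cong₂; subst; setoid; module ≡-Reasoning)

module FiniteSum where

  opaque
    Σ : ℕ → (ℕ → ℤ) → ℤ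
    Σ zero    f = + 0
    Σ (suc n) f = f 0 + Σ n (λ k → f (suc k))

  𝟙 : ∀ {a} {P : Set a} → Dec P → ℤ
  𝟙 P? = if does P? then + 1 else + 0

  𝟙≡1 : ∀ {a} {P : Set a} (P? : Dec P) → P → 𝟙 P? ≡ + 1
  𝟙≡1 (yes _) _ = refl
  𝟙≡1 (no ¬p) p = contradiction p ¬p

  𝟙≡0 : ∀ {a} {P : Set a} (P? : Dec P) → ¬ P → 𝟙 P? ≡ + 0
  𝟙≡0 (yes p) ¬p = contradiction p ¬p
  𝟙≡0 (no _)  _  = refl

  𝟙-cong : ∀ {a b} {P : Set a} {Q : Set b} (P? : Dec P) (Q? : Dec Q) →
           (P → Q) → (Q → P) → 𝟙 P? ≡ 𝟙 Q?
  𝟙-cong (yes p) Q? P⇒Q Q⇒P = sym (𝟙≡1 Q? (P⇒Q p))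
  𝟙-cong (no ¬p) Q? P⇒Q Q⇒P = sym (𝟙≡0 Q? (λ q → ¬p (Q⇒P q)))

  𝟙-× : ∀ {a b} {P : Set a} {Q : Set b} (P? : Dec P) (Q? : Dec Q) →
        𝟙 (P? ×-dec Q?) ≡ 𝟙 P? * 𝟙 Q?
  𝟙-× (yes _) (yes _) = refl
  𝟙-× (yes _) (no _)  = refl
  𝟙-× (no _)  (yes _) = refl
  𝟙-× (no _)  (no _)  = refl

  opaque
    unfolding Σ

    Σ-empty : (f : ℕ → ℤ) → Σ 0 f ≡ + 0
    Σ-empty f = refl

    Σ-suc : ∀ n (f : ℕ → ℤ) → Σ (suc n) f ≡ f 0 + Σ n (λ k → f (suc k))
    Σ-suc n f = refl

    Σ-singleton : (f : ℕ → ℤ) → Σ 1 f ≡ f 0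
    Σ-singleton f = ℤP.+-identityʳ (f 0)

    Σ-cong : ∀ n {f g : ℕ → ℤ} → (∀ k → k < n → f k ≡ g k) → Σ n f ≡ Σ n g
    Σ-cong zero    f≡g = refl
    Σ-cong (suc n) f≡g =
      cong₂ _+_ (f≡g 0 (s≤s z≤n)) (Σ-cong n (λ k k<n → f≡g (suc k) (s≤s k<n)))

    Σ-+ : ∀ n (f g : ℕ → ℤ) → Σ n (λ k → f k + g k) ≡ Σ n f + Σ n g
    Σ-+ zero    f g = refl
    Σ-+ (suc n) f g = trans (cong (_+_ (f 0 + g 0)) (Σ-+ n _ _)) (interchange (f 0) (g 0) _ _)
      where
      interchange : ∀ a b c d → a + b + (c + d) ≡ a + c + (b + d)
      interchange = solve-∀

    Σ-*ˡ : ∀ n (c : ℤ) (f : ℕ → ℤ) → Σ n (λ k → c * f k) ≡ c * Σ n f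
    Σ-*ˡ zero    c f = sym (ℤP.*-zeroʳ c)
    Σ-*ˡ (suc n) c f = trans (cong (_+_ (c * f 0)) (Σ-*ˡ n c _)) (sym (ℤP.*-distribˡ-+ c (f 0) _))

    Σ-neg : ∀ n (f : ℕ → ℤ) → Σ n (λ k → - f k) ≡ - Σ n f
    Σ-neg zero    f = refl
    Σ-neg (suc n) f = trans (cong (_+_ (- f 0)) (Σ-neg n _)) (sym (ℤP.neg-distrib-+ (f 0) _))

    Σ-const : ∀ n c → Σ n (λ _ → c) ≡ + n * c
    Σ-const zero    c = sym (ℤP.*-zeroˡ c)
    Σ-const (suc n) c = trans (cong (_+_ c) (Σ-const n c)) (add-one-copy (+ n) c)
      where
      add-one-copy : ∀ m c → c + m * c ≡ (+ 1 + m) * c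
      add-one-copy = solve-∀

    Σ-++ : ∀ m n (f : ℕ → ℤ) → Σ (m ℕ.+ n) f ≡ Σ m f + Σ n (λ k → f (m ℕ.+ k))
    Σ-++ zero    n f = sym (ℤP.+-identityˡ _)
    Σ-++ (suc m) n f = trans (cong (_+_ (f 0)) (Σ-++ m n _)) (sym (ℤP.+-assoc (f 0) _ _))

    Σ-vanish : ∀ n (f : ℕ → ℤ) → (∀ k → k < n → f k ≡ + 0) → Σ n f ≡ + 0
    Σ-vanish n f f≡0 = trans (Σ-cong n f≡0) (trans (Σ-const n (+ 0)) (ℤP.*-zeroʳ (+ n)))

    Σ-≤ : ∀ n (f : ℕ → ℤ) → (∀ k → k < n → f k ℤ.≤ + 1) → Σ n f ℤ.≤ + n
    Σ-≤ zero    f f≤1 = ℤP.≤-refl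
    Σ-≤ (suc n) f f≤1 =
      ℤP.+-mono-≤ (f≤1 0 (s≤s z≤n)) (Σ-≤ n _ (λ k k<n → f≤1 (suc k) (s≤s k<n)))

    Σ-δ : ∀ n c (f : ℕ → ℤ) → c < n → Σ n (λ k → f k * 𝟙 (c ℕ.≟ k)) ≡ f c
    Σ-δ (suc n) zero    f _ = begin
      f 0 * + 1 + Σ n (λ k → f (suc k) * + 0) ≡⟨ cong₂ _+_ (ℤP.*-identityʳ (f 0)) (Σ-vanish n _ (λ k _ → ℤP.*-zeroʳ (f (suc k)))) ⟩
      f 0 + + 0                               ≡⟨ ℤP.+-identityʳ (f 0) ⟩
      f 0                                     ∎
      where open ≡-Reasoning
    Σ-δ (suc n) (suc c) f (s≤s c<n) =
      trans (cong₂ _+_ (ℤP.*-zeroʳ (f 0)) (Σ-δ n c (λ k → f (suc k)) c<n)) (ℤP.+-identityˡ _)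

    Σ-𝟙-atMostOne : ∀ {a} n {P : ℕ → Set a} (P? : ∀ x → Dec (P x)) →
      (∀ x y → x < n → y < n → P x → P y → x ≡ y) → Σ n (λ x → 𝟙 (P? x)) ℤ.≤ + 1
    Σ-𝟙-atMostOne zero    P? unique = ℤ.+≤+ z≤n
    Σ-𝟙-atMostOne (suc n) P? unique with P? 0
    ... | yes P0 = ℤP.≤-reflexive (cong (_+_ (+ 1)) (Σ-vanish n _ others-fail))
      where
      others-fail : ∀ k → k < n → 𝟙 (P? (suc k)) ≡ + 0
      others-fail k k<n = 𝟙≡0 (P? (suc k)) (λ Pk → ℕP.0≢1+n (unique 0 (suc k) (s≤s z≤n) (s≤s k<n) P0 Pk))
    ... | no _   = ℤP.≤-trans (ℤP.≤-reflexive (ℤP.+-identityˡ _)) (Σ-𝟙-atMostOne n (λ x → P? (suc x))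
                     (λ x y x<n y<n Px Py → ℕP.suc-injective (unique (suc x) (suc y) (s≤s x<n) (s≤s y<n) Px Py)))

  Σ-ext : ∀ n {f g : ℕ → ℤ} → (∀ k → f k ≡ g k) → Σ n f ≡ Σ n g
  Σ-ext n f≡g = Σ-cong n (λ k _ → f≡g k)

  Σ-count : ∀ n → Σ n (λ _ → + 1) ≡ + n
  Σ-count n = trans (Σ-const n (+ 1)) (ℤP.*-identityʳ (+ n))

  Σ-*ʳ : ∀ n (c : ℤ) (f : ℕ → ℤ) → Σ n (λ k → f k * c) ≡ Σ n f * c
  Σ-*ʳ n c f = trans (Σ-ext n (λ k → ℤP.*-comm (f k) c)) (trans (Σ-*ˡ n c f) (ℤP.*-comm c _))

  Σ-𝟙-point : ∀ n c → c < n → Σ n (λ k → 𝟙 (c ℕ.≟ k)) ≡ + 1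
  Σ-𝟙-point n c c<n = trans (Σ-ext n (λ k → sym (ℤP.*-identityˡ _))) (Σ-δ n c (λ _ → + 1) c<n)

  Σ-swap : ∀ m n (F : ℕ → ℕ → ℤ) → Σ m (λ i → Σ n (F i)) ≡ Σ n (λ j → Σ m (λ i → F i j))
  Σ-swap zero    n F = begin
    Σ 0 (λ i → Σ n (F i))  ≡⟨ Σ-empty _ ⟩
    + 0                    ≡⟨ Σ-vanish n _ (λ j _ → Σ-empty _) ⟨
    Σ n (λ j → Σ 0 (λ i → F i j)) ∎
    where open ≡-Reasoning
  Σ-swap (suc m) n F = begin
    Σ (suc m) (λ i → Σ n (F i))                                ≡⟨ Σ-suc m _ ⟩
    Σ n (F 0) + Σ m (λ i → Σ n (F (suc i)))                    ≡⟨ cong (_+_ (Σ n (F 0))) (Σ-swap m n (λ i → F (suc i))) ⟩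
    Σ n (F 0) + Σ n (λ j → Σ m (λ i → F (suc i) j))            ≡⟨ Σ-+ n _ _ ⟨
    Σ n (λ j → F 0 j + Σ m (λ i → F (suc i) j))                ≡⟨ Σ-ext n (λ j → Σ-suc m (λ i → F i j)) ⟨
    Σ n (λ j → Σ (suc m) (λ i → F i j))                        ∎
    where open ≡-Reasoning

  Σ-blocks : ∀ p m (F : ℕ → ℤ) → Σ (p ℕ.* m) F ≡ Σ p (λ i → Σ m (λ j → F (i ℕ.* m ℕ.+ j)))
  Σ-blocks zero    m F = trans (Σ-empty F) (sym (Σ-empty _))
  Σ-blocks (suc p) m F = begin
    Σ (m ℕ.+ p ℕ.* m) F                                          ≡⟨ Σ-++ m (p ℕ.* m) F ⟩
    Σ m F + Σ (p ℕ.* m) (λ k → F (m ℕ.+ k))                      ≡⟨ cong (_+_ (Σ m F)) (Σ-blocks p m _) ⟩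
    Σ m F + Σ p (λ i → Σ m (λ j → F (m ℕ.+ (i ℕ.* m ℕ.+ j))))    ≡⟨ cong (_+_ (Σ m F)) (Σ-ext p (λ i → Σ-ext m (λ j → cong F (sym (ℕP.+-assoc m (i ℕ.* m) j))))) ⟩
    Σ m F + Σ p (λ i → Σ m (λ j → F (suc i ℕ.* m ℕ.+ j)))        ≡⟨ Σ-suc p _ ⟨
    Σ (suc p) (λ i → Σ m (λ j → F (i ℕ.* m ℕ.+ j)))            ∎
    where open ≡-Reasoning

  length-filter-applyUpTo : ∀ {a} {P : ℕ → Set a} (P? : ∀ x → Dec (P x)) n (f : ℕ → ℕ) →
                            + length (filter P? (applyUpTo f n)) ≡ Σ n (λ k → 𝟙 (P? (f k)))
  length-filter-applyUpTo P? zero    f = sym (Σ-empty _)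
  length-filter-applyUpTo P? (suc n) f rewrite Σ-suc n (λ k → 𝟙 (P? (f k))) with P? (f 0)
  ... | yes _ = cong (_+_ (+ 1)) (length-filter-applyUpTo P? n (λ k → f (suc k)))
  ... | no _  = trans (length-filter-applyUpTo P? n (λ k → f (suc k))) (sym (ℤP.+-identityˡ _))

  +-≤-≡⇒≡ : ∀ {a b x y} → a ℤ.≤ x → b ℤ.≤ y → a + b ≡ x + y → a ≡ x × b ≡ y
  +-≤-≡⇒≡ {a} {b} {x} {y} a≤x b≤y a+b≡x+y with a ℤ.≟ x
  ... | yes refl = refl , ∙-cancelˡ a b y a+b≡x+y
  ... | no a≢x   = contradiction a+b≡x+y (ℤP.<⇒≢ (ℤP.+-mono-<-≤ (ℤP.≤∧≢⇒< a≤x a≢x) b≤y))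

  Σ≡n⇒≡1 : ∀ n (f : ℕ → ℤ) → (∀ k → k < n → f k ℤ.≤ + 1) → Σ n f ≡ + n → ∀ k → k < n → f k ≡ + 1
  Σ≡n⇒≡1 (suc n) f f≤1 Σ≡n k k<n with +-≤-≡⇒≡ (f≤1 0 (s≤s z≤n)) (Σ-≤ n _ tail≤1) (trans (sym (Σ-suc n f)) Σ≡n)
    where
    tail≤1 : ∀ k → k < n → f (suc k) ℤ.≤ + 1
    tail≤1 k k<n = f≤1 (suc k) (s≤s k<n)
  Σ≡n⇒≡1 (suc n) f f≤1 Σ≡n zero    _         | f0≡1 , _ = f0≡1
  Σ≡n⇒≡1 (suc n) f f≤1 Σ≡n (suc k) (s≤s k<n) | _ , Σ≡n′ =
    Σ≡n⇒≡1 n (λ k → f (suc k)) (λ k k<n → f≤1 (suc k) (s≤s k<n)) Σ≡n′ k k<n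

module Signs where

  open FiniteSum

  Sign : ℤ → Set
  Sign e = e ≡ + 1 ⊎ e ≡ - + 1

  SignOrZero : ℤ → Set
  SignOrZero x = x ≡ + 0 ⊎ Sign x

  signOrZero-* : ∀ {x y} → SignOrZero x → SignOrZero y → SignOrZero (x * y)
  signOrZero-* (inj₁ refl)        _                  = inj₁ refl
  signOrZero-* (inj₂ (inj₁ refl)) y                  = subst SignOrZero (sym (ℤP.*-identityˡ _)) y
  signOrZero-* (inj₂ (inj₂ refl)) (inj₁ refl)        = inj₁ refl
  signOrZero-* (inj₂ (inj₂ refl)) (inj₂ (inj₁ refl)) = inj₂ (inj₂ refl)
  signOrZero-* (inj₂ (inj₂ refl)) (inj₂ (inj₂ refl)) = inj₂ (inj₁ refl)

  2*𝟙[≟sign] : ∀ {x e} → SignOrZero x → Sign e → + 2 * 𝟙 (x ℤ.≟ e) ≡ x * x + e * x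
  2*𝟙[≟sign] (inj₁ refl)        (inj₁ refl) = refl
  2*𝟙[≟sign] (inj₁ refl)        (inj₂ refl) = refl
  2*𝟙[≟sign] (inj₂ (inj₁ refl)) (inj₁ refl) = refl
  2*𝟙[≟sign] (inj₂ (inj₁ refl)) (inj₂ refl) = refl
  2*𝟙[≟sign] (inj₂ (inj₂ refl)) (inj₁ refl) = refl
  2*𝟙[≟sign] (inj₂ (inj₂ refl)) (inj₂ refl) = refl

  4*𝟙[≟sign×≟sign] : ∀ {x y e₁ e₂} → SignOrZero x → SignOrZero y → Sign e₁ → Sign e₂ →
                      + 4 * 𝟙 ((x ℤ.≟ e₁) ×-dec (y ℤ.≟ e₂)) ≡ (x * x + e₁ * x) * (y * y + e₂ * y)
  4*𝟙[≟sign×≟sign] {x} {y} {e₁} {e₂} x± y± e₁± e₂± = begin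
    + 4 * 𝟙 ((x ℤ.≟ e₁) ×-dec (y ℤ.≟ e₂))            ≡⟨ cong (_*_ (+ 4)) (𝟙-× (x ℤ.≟ e₁) (y ℤ.≟ e₂)) ⟩
    + 4 * (𝟙 (x ℤ.≟ e₁) * 𝟙 (y ℤ.≟ e₂))              ≡⟨ regroup (𝟙 (x ℤ.≟ e₁)) (𝟙 (y ℤ.≟ e₂)) ⟩
    (+ 2 * 𝟙 (x ℤ.≟ e₁)) * (+ 2 * 𝟙 (y ℤ.≟ e₂))      ≡⟨ cong₂ _*_ (2*𝟙[≟sign] x± e₁±) (2*𝟙[≟sign] y± e₂±) ⟩
    (x * x + e₁ * x) * (y * y + e₂ * y)              ∎
    where
    open ≡-Reasoning
    regroup : ∀ a b → + 4 * (a * b) ≡ (+ 2 * a) * (+ 2 * b)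
    regroup = solve-∀

module ListProduct where

  open Signs

  ∏ : List ℕ → (ℕ → ℤ) → ℤ
  ∏ qs F = foldr _*_ (+ 1) (map F qs)

  ∏-↭ : ∀ {xs ys} (F : ℕ → ℤ) → xs ↭ ys → ∏ xs F ≡ ∏ ys F
  ∏-↭ F xs↭ys = foldr-commMonoid (setoid ℤ) ℤP.*-1-isCommutativeMonoid (↭⇒↭ₛ (map⁺ F xs↭ys))

  ∏-cong : ∀ {P : ℕ → Set} qs (F G : ℕ → ℤ) → All P qs → (∀ q → P q → F q ≡ G q) → ∏ qs F ≡ ∏ qs G
  ∏-cong []       F G []       F≡G = refl
  ∏-cong (q ∷ qs) F G (Pq ∷ P) F≡G = cong₂ _*_ (F≡G q Pq) (∏-cong qs F G P F≡G)

  ∏-* : ∀ qs (F G : ℕ → ℤ) → ∏ qs F * ∏ qs G ≡ ∏ qs (λ q → F q * G q)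
  ∏-* []       F G = refl
  ∏-* (q ∷ qs) F G = trans (interchange (F q) (G q) (∏ qs F) (∏ qs G)) (cong (_*_ (F q * G q)) (∏-* qs F G))
    where
    interchange : ∀ a b c d → a * c * (b * d) ≡ a * b * (c * d)
    interchange = solve-∀

  ∏-neg : ∀ qs (F : ℕ → ℤ) → ∏ qs (λ q → - F q) ≡ (- + 1) ^ length qs * ∏ qs F
  ∏-neg []       F = sym (ℤP.*-identityˡ (+ 1))
  ∏-neg (q ∷ qs) F = trans (cong (_*_ (- F q)) (∏-neg qs F)) (pull-sign (F q) ((- + 1) ^ length qs) (∏ qs F))
    where
    pull-sign : ∀ a s r → - a * (s * r) ≡ - + 1 * s * (a * r)
    pull-sign = solve-∀

  ∏-zero : ∀ qs (F : ℕ → ℤ) {q} → q ∈ qs → F q ≡ + 0 → ∏ qs F ≡ + 0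
  ∏-zero (q ∷ qs) F (here refl) Fq≡0 = cong (_* ∏ qs F) Fq≡0
  ∏-zero (q ∷ qs) F (there q∈)  Fq≡0 = trans (cong (_*_ (F q)) (∏-zero qs F q∈ Fq≡0)) (ℤP.*-zeroʳ (F q))

  ∏-signOrZero : ∀ qs (F : ℕ → ℤ) → All (λ q → SignOrZero (F q)) qs → SignOrZero (∏ qs F)
  ∏-signOrZero []       F []       = inj₂ (inj₁ refl)
  ∏-signOrZero (q ∷ qs) F (s ∷ ss) = signOrZero-* s (∏-signOrZero qs F ss)

module PeriodicSum where

  open FiniteSum
  open ListProduct
  open +-*-Solver using (solve; _:+_; _:*_; _:=_)

  Periodic : ℕ → (ℕ → ℤ) → Set
  Periodic m h = ∀ n → h (n ℕ.+ m) ≡ h n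

  module _ {m : ℕ} {h : ℕ → ℤ} (h-periodic : Periodic m h) where

    periodic-+* : ∀ r k → h (r ℕ.+ k ℕ.* m) ≡ h r
    periodic-+* r zero    = cong h (ℕP.+-identityʳ r)
    periodic-+* r (suc k) = begin
      h (r ℕ.+ (m ℕ.+ k ℕ.* m)) ≡⟨ cong h (solve 3 (λ r m k → r :+ (m :+ k :* m) := (r :+ k :* m) :+ m) refl r m k) ⟩
      h (r ℕ.+ k ℕ.* m ℕ.+ m)   ≡⟨ h-periodic _ ⟩
      h (r ℕ.+ k ℕ.* m)         ≡⟨ periodic-+* r k ⟩
      h r                       ∎
      where open ≡-Reasoning

    periodic-% : .{{_ : NonZero m}} → ∀ n → h (n % m) ≡ h n
    periodic-% n = sym (trans (cong h (m≡m%n+[m/n]*n n m)) (periodic-+* (n % m) (n / m)))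

    periodic-∣ : ∀ {M} → m ∣ M → Periodic M h
    periodic-∣ (divides k refl) n = periodic-+* n k

    periodic-shift : ∀ c → Periodic m (λ a → h (a ℕ.+ c))
    periodic-shift c a = trans (cong h (solve 3 (λ a m c → (a :+ m) :+ c := (a :+ c) :+ m) refl a m c)) (h-periodic (a ℕ.+ c))

  periodic-* : ∀ {m} {f g : ℕ → ℤ} → Periodic m f → Periodic m g → Periodic m (λ a → f a * g a)
  periodic-* f-periodic g-periodic a = cong₂ _*_ (f-periodic a) (g-periodic a)

  %-cancelˡ-∣ : ∀ m .{{_ : NonZero m}} b t → (b ℕ.+ t) % m ≡ b % m → m ∣ t
  %-cancelˡ-∣ m b t eq = divides (q₁ ∸ q₂) (begin
      t                                                     ≡⟨ ℕP.m+n∸m≡n b t ⟨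
      b ℕ.+ t ∸ b                                           ≡⟨ cong₂ _∸_ (m≡m%n+[m/n]*n (b ℕ.+ t) m) (m≡m%n+[m/n]*n b m) ⟩
      (b ℕ.+ t) % m ℕ.+ q₁ ℕ.* m ∸ (b % m ℕ.+ q₂ ℕ.* m)     ≡⟨ cong (λ r → r ℕ.+ q₁ ℕ.* m ∸ (b % m ℕ.+ q₂ ℕ.* m)) eq ⟩
      b % m ℕ.+ q₁ ℕ.* m ∸ (b % m ℕ.+ q₂ ℕ.* m)             ≡⟨ ℕP.[m+n]∸[m+o]≡n∸o (b % m) _ _ ⟩
      q₁ ℕ.* m ∸ q₂ ℕ.* m                                   ≡⟨ ℕP.*-distribʳ-∸ m q₁ q₂ ⟨
      (q₁ ∸ q₂) ℕ.* m                                       ∎)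
    where
    open ≡-Reasoning
    q₁ = (b ℕ.+ t) / m
    q₂ = b / m

  ∣∧<⇒≡0 : ∀ {m t} → m ∣ t → t < m → t ≡ 0
  ∣∧<⇒≡0 {t = zero}  _   _   = refl
  ∣∧<⇒≡0 {t = suc t} m∣t t<m = contradiction (∣⇒≤ m∣t) (ℕP.<⇒≱ t<m)

  affine-injective-≤ : ∀ m .{{_ : NonZero m}} a k → Coprime m k → ∀ x y → x ≤ y → y < m →
                       (a ℕ.+ x ℕ.* k) % m ≡ (a ℕ.+ y ℕ.* k) % m → x ≡ y
  affine-injective-≤ m a k m⊥k x y x≤y y<m eq = begin
    x               ≡⟨ ℕP.+-identityʳ x ⟨
    x ℕ.+ 0         ≡⟨ cong (x ℕ.+_) y∸x≡0 ⟨
    x ℕ.+ (y ∸ x)   ≡⟨ ℕP.m+[n∸m]≡n x≤y ⟩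
    y               ∎
    where
    open ≡-Reasoning
    split : a ℕ.+ y ℕ.* k ≡ (a ℕ.+ x ℕ.* k) ℕ.+ k ℕ.* (y ∸ x)
    split = trans (cong (λ z → a ℕ.+ z ℕ.* k) (sym (ℕP.m+[n∸m]≡n x≤y)))
              (solve 4 (λ a x t k → a :+ (x :+ t) :* k := (a :+ x :* k) :+ k :* t) refl a x (y ∸ x) k)
    y∸x≡0 : y ∸ x ≡ 0
    y∸x≡0 = ∣∧<⇒≡0 (coprime-divisor m⊥k (%-cancelˡ-∣ m _ _ (trans (cong (_% m) (sym split)) (sym eq))))
                   (ℕP.≤-<-trans (ℕP.m∸n≤m y x) y<m)

  affine-injective : ∀ m .{{_ : NonZero m}} a k → Coprime m k → ∀ x y → x < m → y < m →
                     (a ℕ.+ x ℕ.* k) % m ≡ (a ℕ.+ y ℕ.* k) % m → x ≡ y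
  affine-injective m a k m⊥k x y x<m y<m eq with ℕP.≤-total x y
  ... | inj₁ x≤y = affine-injective-≤ m a k m⊥k x y x≤y y<m eq
  ... | inj₂ y≤x = sym (affine-injective-≤ m a k m⊥k y x y≤x x<m (sym eq))

  -- Pigeonhole: the fibres of σ mod m have at most one point and total size m, so each has exactly one.
  module Reindex (m : ℕ) .{{_ : NonZero m}} (σ : ℕ → ℕ)
                 (σ-injective : ∀ x y → x < m → y < m → σ x % m ≡ σ y % m → x ≡ y) where

    fibre : ℕ → ℤ
    fibre b = Σ m (λ x → 𝟙 (σ x % m ℕ.≟ b))

    fibre≡1 : ∀ b → b < m → fibre b ≡ + 1
    fibre≡1 = Σ≡n⇒≡1 m fibre (λ b _ → fibre≤1 b) Σ-fibre
      where
      fibre≤1 : ∀ b → fibre b ℤ.≤ + 1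
      fibre≤1 b = Σ-𝟙-atMostOne m (λ x → σ x % m ℕ.≟ b)
                    (λ x y x<m y<m σx≡b σy≡b → σ-injective x y x<m y<m (trans σx≡b (sym σy≡b)))

      Σ-fibre : Σ m fibre ≡ + m
      Σ-fibre = begin
        Σ m (λ b → Σ m (λ x → 𝟙 (σ x % m ℕ.≟ b)))  ≡⟨ Σ-swap m m _ ⟩
        Σ m (λ x → Σ m (λ b → 𝟙 (σ x % m ℕ.≟ b)))  ≡⟨ Σ-ext m (λ x → Σ-𝟙-point m (σ x % m) (m%n<n (σ x) m)) ⟩
        Σ m (λ _ → + 1)                            ≡⟨ Σ-count m ⟩
        + m                                        ∎
        where open ≡-Reasoning

    Σ-reindex : (h : ℕ → ℤ) → Periodic m h → Σ m (λ x → h (σ x)) ≡ Σ m h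
    Σ-reindex h h-periodic = begin
      Σ m (λ x → h (σ x))                                  ≡⟨ Σ-ext m (λ x → periodic-% h-periodic (σ x)) ⟨
      Σ m (λ x → h (σ x % m))                              ≡⟨ Σ-ext m (λ x → Σ-δ m (σ x % m) h (m%n<n (σ x) m)) ⟨
      Σ m (λ x → Σ m (λ b → h b * 𝟙 (σ x % m ℕ.≟ b)))      ≡⟨ Σ-swap m m _ ⟩
      Σ m (λ b → Σ m (λ x → h b * 𝟙 (σ x % m ℕ.≟ b)))      ≡⟨ Σ-ext m (λ b → Σ-*ˡ m (h b) _) ⟩
      Σ m (λ b → h b * fibre b)                            ≡⟨ Σ-cong m (λ b b<m → trans (cong (_*_ (h b)) (fibre≡1 b b<m)) (ℤP.*-identityʳ (h b))) ⟩
      Σ m h                                                ∎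
      where open ≡-Reasoning

  open Reindex using (fibre≡1; Σ-reindex) public

  Σ-shift : ∀ m .{{_ : NonZero m}} (h : ℕ → ℤ) → Periodic m h → ∀ c → Σ m (λ x → h (x ℕ.+ c)) ≡ Σ m h
  Σ-shift m h h-periodic c = trans (Σ-ext m (λ x → cong h (x+c≡c+x*1 x)))
    (Σ-reindex m (λ x → c ℕ.+ x ℕ.* 1) (affine-injective m c 1 (Coprime.sym (Coprime.1-coprimeTo m))) h h-periodic)
    where
    x+c≡c+x*1 : ∀ x → x ℕ.+ c ≡ c ℕ.+ x ℕ.* 1
    x+c≡c+x*1 x = trans (ℕP.+-comm x c) (cong (c ℕ.+_) (sym (ℕP.*-identityʳ x)))

  -- Chinese remainder theorem: for fixed j, the numbers j + i m with i < p run over all residues mod p.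
  Σ-*-coprime : ∀ p m .{{_ : NonZero p}} .{{_ : NonZero m}} → Coprime p m → (f h : ℕ → ℤ) →
                Periodic p f → Periodic m h → Σ (p ℕ.* m) (λ α → f α * h α) ≡ Σ p f * Σ m h
  Σ-*-coprime p m p⊥m f h f-periodic h-periodic = begin
    Σ (p ℕ.* m) (λ α → f α * h α)                                          ≡⟨ Σ-blocks p m _ ⟩
    Σ p (λ i → Σ m (λ j → f (i ℕ.* m ℕ.+ j) * h (i ℕ.* m ℕ.+ j)))          ≡⟨ Σ-ext p (λ i → Σ-ext m (λ j → cong₂ _*_ (cong f (ℕP.+-comm (i ℕ.* m) j))
                                                                               (trans (cong h (ℕP.+-comm (i ℕ.* m) j)) (periodic-+* h-periodic j i)))) ⟩
    Σ p (λ i → Σ m (λ j → f (j ℕ.+ i ℕ.* m) * h j))                        ≡⟨ Σ-swap p m _ ⟩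
    Σ m (λ j → Σ p (λ i → f (j ℕ.+ i ℕ.* m) * h j))                        ≡⟨ Σ-ext m (λ j → Σ-*ʳ p (h j) _) ⟩
    Σ m (λ j → Σ p (λ i → f (j ℕ.+ i ℕ.* m)) * h j)                        ≡⟨ Σ-ext m (λ j → cong (_* h j)
                                                                               (Σ-reindex p (λ i → j ℕ.+ i ℕ.* m) (affine-injective p j m p⊥m) f f-periodic)) ⟩
    Σ m (λ j → Σ p f * h j)                                                ≡⟨ Σ-*ˡ m (Σ p f) h ⟩
    Σ p f * Σ m h                                                          ∎
    where open ≡-Reasoning

  periodic-∏ : ∀ qs M (f : ℕ → ℕ → ℤ) → All (λ q → Periodic q (f q)) qs → All (_∣ M) qs →
               Periodic M (λ α → ∏ qs (λ q → f q α))
  periodic-∏ []       M f []       []         n = refl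
  periodic-∏ (q ∷ qs) M f (fq ∷ fs) (q∣M ∷ ∣M) n = cong₂ _*_ (periodic-∣ fq q∣M n) (periodic-∏ qs M f fs ∣M n)

  prime∤⇒coprime : ∀ {p n} → Prime p → ¬ (p ∣ n) → Coprime p n
  prime∤⇒coprime p-prime p∤n (d∣p , d∣n) with prime⇒irreducible p-prime d∣p
  ... | inj₁ d≡1  = d≡1
  ... | inj₂ refl = contradiction d∣n p∤n

  Σ-∏ : ∀ qs (f : ℕ → ℕ → ℤ) → All Prime qs → Unique qs → All (λ q → Periodic q (f q)) qs →
        .{{_ : NonZero (product qs)}} →
        Σ (product qs) (λ α → ∏ qs (λ q → f q α)) ≡ ∏ qs (λ q → Σ q (f q))
  Σ-∏ []       f _                 _            _                     = Σ-singleton _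
  Σ-∏ (q ∷ qs) f (q-prime ∷ primes) (q∉ ∷ unique) (fq-periodic ∷ periodic) =
    trans (Σ-*-coprime q (product qs) {{prime⇒nonZero q-prime}} {{productOfPrimes≢0 primes}} q⊥qs (f q) _ fq-periodic
                       (periodic-∏ qs (product qs) f periodic (All.tabulate ∈⇒∣product)))
          (cong (_*_ (Σ q (f q))) (Σ-∏ qs f primes unique periodic {{productOfPrimes≢0 primes}}))
    where
    q⊥qs : Coprime q (product qs)
    q⊥qs = prime∤⇒coprime q-prime (λ q∣qs → All.lookup q∉ (factorisationHasAllPrimeFactors q-prime q∣qs primes) refl)

module Legendre (k : ℕ) (p-prime : Prime (suc k)) (p≢2 : suc k ≢ 2) where

  open FiniteSum
  open Signs
  open PeriodicSum
  open +-*-Solver using (solve; _:+_; _:*_; _:=_)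

  p : ℕ
  p = suc k

  -- legendre z p unfolds to symbol (z ℤ.%ℕ p).
  symbol : ℕ → ℤ
  symbol r = if does (r ℕ.≟ 0) then + 0
             else if does (any? (λ x → x ℕ.* x % p ℕ.≟ r) (upTo p)) then + 1
             else - + 1

  χ : ℕ → ℤ
  χ n = legendre (+ n) p

  δ : ℕ → ℤ
  δ n = 𝟙 (n % p ℕ.≟ 0)

  χ-periodic : Periodic p χ
  χ-periodic n = cong symbol ([m+n]%n≡m%n n p)

  δ-periodic : Periodic p δ
  δ-periodic n = cong (λ r → 𝟙 (r ℕ.≟ 0)) ([m+n]%n≡m%n n p)

  symbol-sign : ∀ r → Sign (symbol (suc r))
  symbol-sign r = if-sign (does (any? (λ x → x ℕ.* x % p ℕ.≟ suc r) (upTo p)))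
    where
    if-sign : ∀ b → Sign (if b then + 1 else - + 1)
    if-sign true  = inj₁ refl
    if-sign false = inj₂ refl

  symbol-signOrZero : ∀ r → SignOrZero (symbol r)
  symbol-signOrZero zero    = inj₁ refl
  symbol-signOrZero (suc r) = inj₂ (symbol-sign r)

  χ²≡1-δ : ∀ n → χ n * χ n ≡ + 1 - δ n
  χ²≡1-δ n = symbol² (n % p)
    where
    symbol² : ∀ r → symbol r * symbol r ≡ + 1 - 𝟙 (r ℕ.≟ 0)
    symbol² zero = refl
    symbol² (suc r) with symbol-sign r
    ... | inj₁ s≡1  = cong (λ s → s * s) s≡1
    ... | inj₂ s≡-1 = cong (λ s → s * s) s≡-1

  𝟙[coprime]≡χ² : ∀ α → 𝟙 (coprime? α p) ≡ χ α * χ α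
  𝟙[coprime]≡χ² α = trans (𝟙[coprime]≡1-δ (α % p ℕ.≟ 0)) (sym (χ²≡1-δ α))
    where
    𝟙[coprime]≡1-δ : (p∣α? : Dec (α % p ≡ 0)) → 𝟙 (coprime? α p) ≡ + 1 - 𝟙 p∣α?
    𝟙[coprime]≡1-δ (yes α%p≡0) = 𝟙≡0 (coprime? α p) (λ α⊥p → ¬prime[1] (subst Prime (α⊥p (m%n≡0⇒n∣m α p α%p≡0 , ∣-refl)) p-prime))
    𝟙[coprime]≡1-δ (no α%p≢0)  = 𝟙≡1 (coprime? α p) (Coprime.sym (prime∤⇒coprime p-prime (λ p∣α → α%p≢0 (n∣m⇒m%n≡0 α p p∣α))))

  χ-∣ : ∀ d → p ∣ d → χ d ≡ + 0
  χ-∣ d p∣d = cong symbol (n∣m⇒m%n≡0 d p p∣d)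

  p∤2 : ¬ (p ∣ 2)
  p∤2 p∣2 with prime⇒irreducible prime[2] p∣2
  ... | inj₁ refl = ¬prime[1] p-prime
  ... | inj₂ p≡2  = p≢2 p≡2

  2∤p : ¬ (2 ∣ p)
  2∤p 2∣p with prime⇒irreducible p-prime 2∣p
  ... | inj₁ ()
  ... | inj₂ 2≡p = p≢2 (sym 2≡p)

  p∣x²⇒x≡0 : ∀ x → x < p → p ∣ x ℕ.* x → x ≡ 0
  p∣x²⇒x≡0 x x<p p∣x² with euclidsLemma x x p-prime p∣x²
  ... | inj₁ p∣x = ∣∧<⇒≡0 p∣x x<p
  ... | inj₂ p∣x = ∣∧<⇒≡0 p∣x x<p

  p∣n<2p⇒n≡p : ∀ n → p ∣ n → 0 < n → n < p ℕ.+ p → n ≡ p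
  p∣n<2p⇒n≡p n (divides zero          refl) () _
  p∣n<2p⇒n≡p n (divides (suc zero)    refl) _  _    = ℕP.+-identityʳ p
  p∣n<2p⇒n≡p n (divides (suc (suc q)) refl) _  n<2p =
    contradiction (ℕP.+-monoʳ-≤ p (ℕP.m≤m+n p (q ℕ.* p))) (ℕP.<⇒≱ n<2p)

  square-difference : ∀ a b → a ≤ b → b ℕ.* b ≡ a ℕ.* a ℕ.+ (b ∸ a) ℕ.* (b ℕ.+ a)
  square-difference a b a≤b = begin
    b ℕ.* b                                   ≡⟨ cong (λ z → z ℕ.* z) (ℕP.m+[n∸m]≡n a≤b) ⟨
    (a ℕ.+ t) ℕ.* (a ℕ.+ t)                   ≡⟨ solve 2 (λ a t → (a :+ t) :* (a :+ t) := a :* a :+ t :* ((a :+ t) :+ a)) refl a t ⟩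
    a ℕ.* a ℕ.+ t ℕ.* ((a ℕ.+ t) ℕ.+ a)       ≡⟨ cong (λ z → a ℕ.* a ℕ.+ t ℕ.* (z ℕ.+ a)) (ℕP.m+[n∸m]≡n a≤b) ⟩
    a ℕ.* a ℕ.+ t ℕ.* (b ℕ.+ a)               ∎
    where
    open ≡-Reasoning
    t = b ∸ a

  x²≡y²⇒ : ∀ x y → x ≤ y → y < p → 0 < y → x ℕ.* x % p ≡ y ℕ.* y % p → x ≡ y ⊎ x ℕ.+ y ≡ p
  x²≡y²⇒ x y x≤y y<p 0<y x²≡y² with euclidsLemma (y ∸ x) (y ℕ.+ x) p-prime
    (%-cancelˡ-∣ p (x ℕ.* x) _ (trans (cong (_% p) (sym (square-difference x y x≤y))) (sym x²≡y²)))
  ... | inj₁ p∣y-x = inj₁ (begin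
    x               ≡⟨ ℕP.+-identityʳ x ⟨
    x ℕ.+ 0         ≡⟨ cong (x ℕ.+_) (∣∧<⇒≡0 p∣y-x (ℕP.≤-<-trans (ℕP.m∸n≤m y x) y<p)) ⟨
    x ℕ.+ (y ∸ x)   ≡⟨ ℕP.m+[n∸m]≡n x≤y ⟩
    y               ∎)
    where open ≡-Reasoning
  ... | inj₂ p∣y+x = inj₂ (trans (ℕP.+-comm x y)
    (p∣n<2p⇒n≡p (y ℕ.+ x) p∣y+x (ℕP.<-≤-trans 0<y (ℕP.m≤m+n y x))
                (ℕP.+-mono-<-≤ y<p (ℕP.<⇒≤ (ℕP.≤-<-trans x≤y y<p)))))

  roots : ℕ → ℤ
  roots r = Σ p (λ x → 𝟙 (x ℕ.* x % p ℕ.≟ r))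

  roots[0]≡1 : roots 0 ≡ + 1
  roots[0]≡1 = trans (Σ-cong p only-0) (Σ-𝟙-point p 0 (s≤s z≤n))
    where
    only-0 : ∀ x → x < p → 𝟙 (x ℕ.* x % p ℕ.≟ 0) ≡ 𝟙 (0 ℕ.≟ x)
    only-0 x x<p = 𝟙-cong (x ℕ.* x % p ℕ.≟ 0) (0 ℕ.≟ x)
      (λ x²%p≡0 → sym (p∣x²⇒x≡0 x x<p (m%n≡0⇒n∣m _ p x²%p≡0))) (λ { refl → refl })

  -- A nonzero square x₀² has exactly the two square roots x₀ and p − x₀, which differ as p is odd.
  module TwoRoots (x₀ : ℕ) (x₀<p : x₀ < p) (x₀≢0 : x₀ ≢ 0) where

    x₁ : ℕ
    x₁ = p ∸ x₀

    x₀+x₁≡p : x₀ ℕ.+ x₁ ≡ p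
    x₀+x₁≡p = ℕP.m+[n∸m]≡n (ℕP.<⇒≤ x₀<p)

    x₁<p : x₁ < p
    x₁<p = ℕP.∸-monoʳ-< {p} {x₀} {0} (ℕP.n≢0⇒n>0 x₀≢0) (ℕP.<⇒≤ x₀<p)

    x₀≢x₁ : x₀ ≢ x₁
    x₀≢x₁ x₀≡x₁ = 2∤p (divides x₀ (begin
      p                ≡⟨ x₀+x₁≡p ⟨
      x₀ ℕ.+ x₁        ≡⟨ cong (x₀ ℕ.+_) x₀≡x₁ ⟨
      x₀ ℕ.+ x₀        ≡⟨ trans (cong (x₀ ℕ.+_) (sym (ℕP.+-identityʳ x₀))) (ℕP.*-comm 2 x₀) ⟩
      x₀ ℕ.* 2         ∎))
      where open ≡-Reasoning

    x₁²≡x₀² : x₁ ℕ.* x₁ % p ≡ x₀ ℕ.* x₀ % p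
    x₁²≡x₀² = begin
      x₁ ℕ.* x₁ % p                                ≡⟨ [m+kn]%n≡m%n (x₁ ℕ.* x₁) x₀ p ⟨
      (x₁ ℕ.* x₁ ℕ.+ x₀ ℕ.* p) % p                 ≡⟨ cong (λ z → (x₁ ℕ.* x₁ ℕ.+ x₀ ℕ.* z) % p) x₀+x₁≡p ⟨
      (x₁ ℕ.* x₁ ℕ.+ x₀ ℕ.* (x₀ ℕ.+ x₁)) % p       ≡⟨ cong (_% p) (solve 2 (λ a b → b :* b :+ a :* (a :+ b) := a :* a :+ b :* (a :+ b)) refl x₀ x₁) ⟩
      (x₀ ℕ.* x₀ ℕ.+ x₁ ℕ.* (x₀ ℕ.+ x₁)) % p       ≡⟨ cong (λ z → (x₀ ℕ.* x₀ ℕ.+ x₁ ℕ.* z) % p) x₀+x₁≡p ⟩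
      (x₀ ℕ.* x₀ ℕ.+ x₁ ℕ.* p) % p                 ≡⟨ [m+kn]%n≡m%n (x₀ ℕ.* x₀) x₁ p ⟩
      x₀ ℕ.* x₀ % p                                ∎
      where open ≡-Reasoning

    root⇒x₀⊎x₁ : ∀ x → x < p → x ℕ.* x % p ≡ x₀ ℕ.* x₀ % p → x ≡ x₀ ⊎ x ≡ x₁
    root⇒x₀⊎x₁ x x<p x²≡x₀² with ℕP.≤-total x x₀
    ... | inj₁ x≤x₀ = Sum.map₂ (λ x+x₀≡p → trans (sym (ℕP.m+n∸n≡m x x₀)) (cong (_∸ x₀) x+x₀≡p))
                        (x²≡y²⇒ x x₀ x≤x₀ x₀<p (ℕP.n≢0⇒n>0 x₀≢0) x²≡x₀²)
    ... | inj₂ x₀≤x = Sum.map sym (λ x₀+x≡p → trans (sym (ℕP.m+n∸m≡n x₀ x)) (cong (_∸ x₀) x₀+x≡p))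
                        (x²≡y²⇒ x₀ x x₀≤x x<p (ℕP.<-≤-trans (ℕP.n≢0⇒n>0 x₀≢0) x₀≤x) (sym x²≡x₀²))

    root-indicator : ∀ x → x < p → 𝟙 (x ℕ.* x % p ℕ.≟ x₀ ℕ.* x₀ % p) ≡ 𝟙 (x₀ ℕ.≟ x) + 𝟙 (x₁ ℕ.≟ x)
    root-indicator x x<p with x₀ ℕ.≟ x | x₁ ℕ.≟ x
    ... | yes refl  | yes x₁≡x₀ = contradiction (sym x₁≡x₀) x₀≢x₁
    ... | yes refl  | no x₁≢x   = begin
      𝟙 (x ℕ.* x % p ℕ.≟ x ℕ.* x % p)  ≡⟨ 𝟙≡1 (x ℕ.* x % p ℕ.≟ x ℕ.* x % p) refl ⟩
      + 1 + + 0                       ≡⟨ cong₂ _+_ (𝟙≡1 (x ℕ.≟ x) refl) (𝟙≡0 (x₁ ℕ.≟ x) x₁≢x) ⟨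
      𝟙 (x ℕ.≟ x) + 𝟙 (x₁ ℕ.≟ x)       ∎
      where open ≡-Reasoning
    ... | no x₀≢x   | yes refl  = begin
      𝟙 (x ℕ.* x % p ℕ.≟ x₀ ℕ.* x₀ % p)  ≡⟨ 𝟙≡1 (x ℕ.* x % p ℕ.≟ x₀ ℕ.* x₀ % p) x₁²≡x₀² ⟩
      + 0 + + 1                         ≡⟨ cong₂ _+_ (𝟙≡0 (x₀ ℕ.≟ x) x₀≢x) (𝟙≡1 (x ℕ.≟ x) refl) ⟨
      𝟙 (x₀ ℕ.≟ x) + 𝟙 (x ℕ.≟ x)         ∎
      where open ≡-Reasoning
    ... | no x₀≢x   | no x₁≢x   = begin
      𝟙 (x ℕ.* x % p ℕ.≟ x₀ ℕ.* x₀ % p)  ≡⟨ 𝟙≡0 (x ℕ.* x % p ℕ.≟ x₀ ℕ.* x₀ % p) not-root ⟩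
      + 0 + + 0                         ≡⟨ cong₂ _+_ (𝟙≡0 (x₀ ℕ.≟ x) x₀≢x) (𝟙≡0 (x₁ ℕ.≟ x) x₁≢x) ⟨
      𝟙 (x₀ ℕ.≟ x) + 𝟙 (x₁ ℕ.≟ x)        ∎
      where
      open ≡-Reasoning
      not-root : x ℕ.* x % p ≢ x₀ ℕ.* x₀ % p
      not-root x²≡x₀² = [ (λ x≡x₀ → x₀≢x (sym x≡x₀)) , (λ x≡x₁ → x₁≢x (sym x≡x₁)) ]′ (root⇒x₀⊎x₁ x x<p x²≡x₀²)

    roots≡2 : roots (x₀ ℕ.* x₀ % p) ≡ + 2
    roots≡2 = begin
      roots (x₀ ℕ.* x₀ % p)                                   ≡⟨ Σ-cong p root-indicator ⟩
      Σ p (λ x → 𝟙 (x₀ ℕ.≟ x) + 𝟙 (x₁ ℕ.≟ x))                 ≡⟨ Σ-+ p _ _ ⟩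
      Σ p (λ x → 𝟙 (x₀ ℕ.≟ x)) + Σ p (λ x → 𝟙 (x₁ ℕ.≟ x))     ≡⟨ cong₂ _+_ (Σ-𝟙-point p x₀ x₀<p) (Σ-𝟙-point p x₁ x₁<p) ⟩
      + 2                                                     ∎
      where open ≡-Reasoning

  roots-of-nonzero : ∀ r (∃root? : Dec (Any (λ x → x ℕ.* x % p ≡ suc r) (upTo p))) →
                     roots (suc r) ≡ + 1 + (if does ∃root? then + 1 else - + 1)
  roots-of-nonzero r (yes ∃root) with find ∃root
  ... | x₀ , x₀∈ , x₀²≡r = subst (λ r → roots r ≡ + 2) x₀²≡r (TwoRoots.roots≡2 x₀ (∈-upTo⁻ x₀∈) x₀≢0)
    where
    x₀≢0 : x₀ ≢ 0
    x₀≢0 refl = ℕP.0≢1+n x₀²≡r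
  roots-of-nonzero r (no ∄root) =
    Σ-vanish p _ (λ x x<p → 𝟙≡0 (x ℕ.* x % p ℕ.≟ suc r) (λ x²≡r → ∄root (lose (∈-upTo⁺ x<p) x²≡r)))

  roots≡1+symbol : ∀ r → roots r ≡ + 1 + symbol r
  roots≡1+symbol zero    = roots[0]≡1
  roots≡1+symbol (suc r) = roots-of-nonzero r (any? (λ x → x ℕ.* x % p ℕ.≟ suc r) (upTo p))

  roots≡1+χ : ∀ n → roots (n % p) ≡ + 1 + χ n
  roots≡1+χ n = roots≡1+symbol (n % p)

  Σ-*δ : (F : ℕ → ℤ) → Σ p (λ a → F a * δ a) ≡ F 0
  Σ-*δ F = trans (Σ-cong p (λ a a<p → cong (_*_ (F a)) (δ≡𝟙[0≟] a a<p))) (Σ-δ p 0 F (s≤s z≤n))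
    where
    δ≡𝟙[0≟] : ∀ a → a < p → δ a ≡ 𝟙 (0 ℕ.≟ a)
    δ≡𝟙[0≟] a a<p = 𝟙-cong (a % p ℕ.≟ 0) (0 ℕ.≟ a) (λ a%p≡0 → trans (sym a%p≡0) (m<n⇒m%n≡m a<p))
                                                    (λ 0≡a → trans (m<n⇒m%n≡m a<p) (sym 0≡a))

  Σ-roots≡p : Σ p (λ a → roots (a % p)) ≡ + p
  Σ-roots≡p = begin
    Σ p (λ a → Σ p (λ x → 𝟙 (x ℕ.* x % p ℕ.≟ a % p)))  ≡⟨ Σ-swap p p _ ⟩
    Σ p (λ x → Σ p (λ a → 𝟙 (x ℕ.* x % p ℕ.≟ a % p)))  ≡⟨ Σ-ext p (λ x → Σ-cong p (λ a a<p → cong (λ r → 𝟙 (x ℕ.* x % p ℕ.≟ r)) (m<n⇒m%n≡m a<p))) ⟩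
    Σ p (λ x → Σ p (λ a → 𝟙 (x ℕ.* x % p ℕ.≟ a)))      ≡⟨ Σ-ext p (λ x → Σ-𝟙-point p (x ℕ.* x % p) (m%n<n (x ℕ.* x) p)) ⟩
    Σ p (λ _ → + 1)                                    ≡⟨ Σ-count p ⟩
    + p                                                ∎
    where open ≡-Reasoning

  Σ-χ≡0 : Σ p χ ≡ + 0
  Σ-χ≡0 = ∙-cancelˡ (+ p) (Σ p χ) (+ 0) (begin
    + p + Σ p χ              ≡⟨ cong (_+ Σ p χ) (Σ-count p) ⟨
    Σ p (λ _ → + 1) + Σ p χ  ≡⟨ Σ-+ p _ χ ⟨
    Σ p (λ a → + 1 + χ a)    ≡⟨ Σ-ext p roots≡1+χ ⟨
    Σ p (λ a → roots (a % p)) ≡⟨ Σ-roots≡p ⟩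
    + p                      ≡⟨ ℤP.+-identityʳ (+ p) ⟨
    + p + + 0                ∎)
    where open ≡-Reasoning

  Σ-χ+c≡0 : ∀ c → Σ p (λ a → χ (a ℕ.+ c)) ≡ + 0
  Σ-χ+c≡0 c = trans (Σ-shift p χ χ-periodic c) Σ-χ≡0

  Σ-χ²χ+ : ∀ d → Σ p (λ a → χ a * χ a * χ (a ℕ.+ d)) ≡ - χ d
  Σ-χ²χ+ d = begin
    Σ p (λ a → χ a * χ a * χ (a ℕ.+ d))                          ≡⟨ Σ-ext p (λ a → cong (_* χ (a ℕ.+ d)) (χ²≡1-δ a)) ⟩
    Σ p (λ a → (+ 1 - δ a) * χ (a ℕ.+ d))                        ≡⟨ Σ-ext p (λ a → expand (δ a) (χ (a ℕ.+ d))) ⟩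
    Σ p (λ a → χ (a ℕ.+ d) + - (χ (a ℕ.+ d) * δ a))              ≡⟨ Σ-+ p _ _ ⟩
    Σ p (λ a → χ (a ℕ.+ d)) + Σ p (λ a → - (χ (a ℕ.+ d) * δ a))  ≡⟨ cong₂ _+_ (Σ-χ+c≡0 d) (Σ-neg p _) ⟩
    + 0 + - Σ p (λ a → χ (a ℕ.+ d) * δ a)                        ≡⟨ cong (λ z → + 0 + - z) (Σ-*δ (λ a → χ (a ℕ.+ d))) ⟩
    + 0 + - χ d                                                  ≡⟨ ℤP.+-identityˡ _ ⟩
    - χ d                                                        ∎
    where
    open ≡-Reasoning
    expand : ∀ D X → (+ 1 - D) * X ≡ X + - (X * D)
    expand = solve-∀

  Σ-χχ+-∣ : ∀ d → p ∣ d → Σ p (λ a → χ a * χ (a ℕ.+ d)) ≡ + k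
  Σ-χχ+-∣ d (divides q refl) = begin
    Σ p (λ a → χ a * χ (a ℕ.+ q ℕ.* p))        ≡⟨ Σ-ext p (λ a → trans (cong (_*_ (χ a)) (periodic-+* χ-periodic a q)) (χ²≡1-δ a)) ⟩
    Σ p (λ a → + 1 - δ a)                      ≡⟨ Σ-+ p _ _ ⟩
    Σ p (λ _ → + 1) + Σ p (λ a → - δ a)        ≡⟨ cong₂ _+_ (Σ-count p) (Σ-neg p δ) ⟩
    + p - Σ p δ                                ≡⟨ cong (λ z → + p - z) (trans (Σ-ext p (λ a → sym (ℤP.*-identityˡ (δ a)))) (Σ-*δ (λ _ → + 1))) ⟩
    + k                                        ∎
    where open ≡-Reasoning

  negate : ℕ → ℕ
  negate d = p ∸ d % p

  negate-+ : ∀ a d → (a ℕ.+ negate d ℕ.+ d) % p ≡ a % p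
  negate-+ a d = begin
    (a ℕ.+ negate d ℕ.+ d) % p                                ≡⟨ cong (λ z → (a ℕ.+ negate d ℕ.+ z) % p) (m≡m%n+[m/n]*n d p) ⟩
    (a ℕ.+ (p ∸ d % p) ℕ.+ (d % p ℕ.+ d / p ℕ.* p)) % p       ≡⟨ cong (_% p) (solve 5 (λ a x r q p → a :+ x :+ (r :+ q :* p) := a :+ (x :+ r) :+ q :* p)
                                                                                     refl a (p ∸ d % p) (d % p) (d / p) p) ⟩
    (a ℕ.+ ((p ∸ d % p) ℕ.+ d % p) ℕ.+ d / p ℕ.* p) % p       ≡⟨ [m+kn]%n≡m%n (a ℕ.+ ((p ∸ d % p) ℕ.+ d % p)) (d / p) p ⟩
    (a ℕ.+ ((p ∸ d % p) ℕ.+ d % p)) % p                       ≡⟨ cong (λ z → (a ℕ.+ z) % p) (ℕP.m∸n+n≡m (ℕP.<⇒≤ (m%n<n d p))) ⟩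
    (a ℕ.+ p) % p                                             ≡⟨ [m+n]%n≡m%n a p ⟩
    a % p                                                     ∎
    where open ≡-Reasoning

  χ-negate-∣ : ∀ d → p ∣ d → χ (negate d) ≡ + 0
  χ-negate-∣ d p∣d = trans (cong (λ r → symbol ((p ∸ r) % p)) (n∣m⇒m%n≡0 d p p∣d)) (cong symbol (n%n≡0 p))

  χ-negate : ∀ d → d ≢ 0 → χ (negate d) ≡ legendre (- + d) p
  χ-negate zero     d≢0 = contradiction refl d≢0
  χ-negate (suc d′) _   = cong symbol (negate-% d′)
    where
    negate-% : ∀ d′ → (p ∸ suc d′ % p) % p ≡ (- + suc d′) ℤ.%ℕ p
    negate-% d′ with suc d′ % p in d%p≡
    ... | zero  = n%n≡0 p
    ... | suc r = m<n⇒m%n≡m (ℕP.∸-monoʳ-< {p} {suc r} {0} (s≤s z≤n) (subst (_≤ p) d%p≡ (ℕP.<⇒≤ (m%n<n (suc d′) p))))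

  Σ-χχ+² : ∀ d → Σ p (λ a → χ a * (χ (a ℕ.+ d) * χ (a ℕ.+ d))) ≡ - χ (negate d)
  Σ-χχ+² d = begin
    Σ p (λ a → χ a * (χ (a ℕ.+ d) * χ (a ℕ.+ d)))             ≡⟨ Σ-ext p (λ a → cong (_*_ (χ a)) (χ²≡1-δ (a ℕ.+ d))) ⟩
    Σ p (λ a → χ a * (+ 1 - δ (a ℕ.+ d)))                     ≡⟨ Σ-ext p (λ a → expand (χ a) (δ (a ℕ.+ d))) ⟩
    Σ p (λ a → χ a + - (χ a * δ (a ℕ.+ d)))                   ≡⟨ Σ-+ p _ _ ⟩
    Σ p χ + Σ p (λ a → - (χ a * δ (a ℕ.+ d)))                 ≡⟨ cong₂ _+_ Σ-χ≡0 (Σ-neg p _) ⟩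
    + 0 + - Σ p (λ a → χ a * δ (a ℕ.+ d))                     ≡⟨ ℤP.+-identityˡ _ ⟩
    - Σ p (λ a → χ a * δ (a ℕ.+ d))                           ≡⟨ cong -_ (Σ-shift p _ (periodic-* χ-periodic (periodic-shift δ-periodic d)) (negate d)) ⟨
    - Σ p (λ a → χ (a ℕ.+ negate d) * δ (a ℕ.+ negate d ℕ.+ d)) ≡⟨ cong -_ (Σ-ext p (λ a → cong (λ r → χ (a ℕ.+ negate d) * 𝟙 (r ℕ.≟ 0)) (negate-+ a d))) ⟩
    - Σ p (λ a → χ (a ℕ.+ negate d) * δ a)                    ≡⟨ cong -_ (Σ-*δ (λ a → χ (a ℕ.+ negate d))) ⟩
    - χ (negate d)                                            ∎
    where
    open ≡-Reasoning
    expand : ∀ X D → X * (+ 1 - D) ≡ X + - (X * D)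
    expand = solve-∀

  +-%-congˡ : ∀ c a b → a % p ≡ b % p → (c ℕ.+ a) % p ≡ (c ℕ.+ b) % p
  +-%-congˡ c a b a≡b = begin
    (c ℕ.+ a) % p            ≡⟨ %-distribˡ-+ c a p ⟩
    (c % p ℕ.+ a % p) % p    ≡⟨ cong (λ z → (c % p ℕ.+ z) % p) a≡b ⟩
    (c % p ℕ.+ b % p) % p    ≡⟨ %-distribˡ-+ c b p ⟨
    (c ℕ.+ b) % p            ∎
    where open ≡-Reasoning

  +-%-cancelˡ : ∀ c a b → (c ℕ.+ a) % p ≡ (c ℕ.+ b) % p → a % p ≡ b % p
  +-%-cancelˡ c a b c+a≡c+b = begin
    a % p                              ≡⟨ negate-+ a c ⟨
    (a ℕ.+ negate c ℕ.+ c) % p         ≡⟨ cong (_% p) (reassoc a) ⟩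
    (negate c ℕ.+ (c ℕ.+ a)) % p       ≡⟨ +-%-congˡ (negate c) _ _ c+a≡c+b ⟩
    (negate c ℕ.+ (c ℕ.+ b)) % p       ≡⟨ cong (_% p) (reassoc b) ⟨
    (b ℕ.+ negate c ℕ.+ c) % p         ≡⟨ negate-+ b c ⟩
    b % p                              ∎
    where
    open ≡-Reasoning
    reassoc : ∀ x → x ℕ.+ negate c ℕ.+ c ≡ negate c ℕ.+ (c ℕ.+ x)
    reassoc x = solve 3 (λ x n c → x :+ n :+ c := n :+ (c :+ x)) refl x (negate c) c

  -- Writing y = x + u, the equation y² ≡ x² + d becomes u² + 2ux ≡ d: it has no solution x for u = 0
  -- and, 2u being invertible mod p, exactly one for every other u.
  module NonDivisor (d : ℕ) (p∤d : ¬ (p ∣ d)) where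

    solution : ℕ → ℕ → ℤ
    solution x y = 𝟙 (y ℕ.* y % p ℕ.≟ (x ℕ.* x ℕ.+ d) % p)

    linear-solution : ℕ → ℕ → ℤ
    linear-solution u x = 𝟙 ((u ℕ.* u ℕ.+ x ℕ.* (u ℕ.+ u)) % p ℕ.≟ d % p)

    solution-periodic : ∀ x → Periodic p (solution x)
    solution-periodic x y = cong (λ r → 𝟙 (r ℕ.≟ (x ℕ.* x ℕ.+ d) % p)) (begin
      (y ℕ.+ p) ℕ.* (y ℕ.+ p) % p                   ≡⟨ cong (_% p) (solve 2 (λ y p → (y :+ p) :* (y :+ p) := y :* y :+ (y :+ y :+ p) :* p) refl y p) ⟩
      (y ℕ.* y ℕ.+ (y ℕ.+ y ℕ.+ p) ℕ.* p) % p       ≡⟨ [m+kn]%n≡m%n (y ℕ.* y) (y ℕ.+ y ℕ.+ p) p ⟩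
      y ℕ.* y % p                                   ∎)
      where open ≡-Reasoning

    solution≡linear-solution : ∀ x u → solution x (u ℕ.+ x) ≡ linear-solution u x
    solution≡linear-solution x u =
      𝟙-cong ((u ℕ.+ x) ℕ.* (u ℕ.+ x) % p ℕ.≟ (x ℕ.* x ℕ.+ d) % p) ((u ℕ.* u ℕ.+ x ℕ.* (u ℕ.+ u)) % p ℕ.≟ d % p)
        (λ y²≡x²+d → +-%-cancelˡ (x ℕ.* x) _ d (trans (cong (_% p) (sym square)) y²≡x²+d))
        (λ u²+2ux≡d → trans (cong (_% p) square) (+-%-congˡ (x ℕ.* x) _ d u²+2ux≡d))
      where
      square : (u ℕ.+ x) ℕ.* (u ℕ.+ x) ≡ x ℕ.* x ℕ.+ (u ℕ.* u ℕ.+ x ℕ.* (u ℕ.+ u))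
      square = solve 2 (λ x u → (u :+ x) :* (u :+ x) := x :* x :+ (u :* u :+ x :* (u :+ u))) refl x u

    Σ-linear-solution[0]≡0 : Σ p (linear-solution 0) ≡ + 0
    Σ-linear-solution[0]≡0 = Σ-vanish p _ (λ x _ → 𝟙≡0 ((0 ℕ.* 0 ℕ.+ x ℕ.* 0) % p ℕ.≟ d % p)
      (λ 0≡d → p∤d (m%n≡0⇒n∣m d p (trans (sym 0≡d) (cong (_% p) (ℕP.*-zeroʳ x))))))

    Σ-linear-solution≡1 : ∀ u → u < p → u ≢ 0 → Σ p (linear-solution u) ≡ + 1
    Σ-linear-solution≡1 u u<p u≢0 =
      fibre≡1 p (λ x → u ℕ.* u ℕ.+ x ℕ.* (u ℕ.+ u)) (affine-injective p (u ℕ.* u) (u ℕ.+ u) p⊥2u) (d % p) (m%n<n d p)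
      where
      p⊥2u : Coprime p (u ℕ.+ u)
      p⊥2u = prime∤⇒coprime p-prime (λ p∣2u → [ p∤2 , (λ p∣u → u≢0 (∣∧<⇒≡0 p∣u u<p)) ]′
                                                  (euclidsLemma 2 u p-prime (subst (p ∣_) (cong (u ℕ.+_) (sym (ℕP.+-identityʳ u))) p∣2u)))

    #solutions≡k : Σ p (λ x → Σ p (solution x)) ≡ + k
    #solutions≡k = begin
      Σ p (λ x → Σ p (solution x))                          ≡⟨ Σ-ext p (λ x → Σ-shift p (solution x) (solution-periodic x) x) ⟨
      Σ p (λ x → Σ p (λ u → solution x (u ℕ.+ x)))          ≡⟨ Σ-ext p (λ x → Σ-ext p (solution≡linear-solution x)) ⟩
      Σ p (λ x → Σ p (λ u → linear-solution u x))           ≡⟨ Σ-swap p p _ ⟩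
      Σ p (λ u → Σ p (linear-solution u))                   ≡⟨ Σ-suc k _ ⟩
      Σ p (linear-solution 0) + Σ k (λ u → Σ p (linear-solution (suc u)))
                                                            ≡⟨ cong₂ _+_ Σ-linear-solution[0]≡0 (Σ-cong k (λ u u<k → Σ-linear-solution≡1 (suc u) (s≤s u<k) (λ ()))) ⟩
      + 0 + Σ k (λ _ → + 1)                                 ≡⟨ trans (ℤP.+-identityˡ _) (Σ-count k) ⟩
      + k                                                   ∎
      where open ≡-Reasoning

    Σ-χ[x²+d]≡-1 : Σ p (λ x → χ (x ℕ.* x ℕ.+ d)) ≡ - + 1
    Σ-χ[x²+d]≡-1 = ∙-cancelˡ (+ p) _ (- + 1) (begin
      + p + Σ p (λ x → χ (x ℕ.* x ℕ.+ d))              ≡⟨ cong (_+ Σ p (λ x → χ (x ℕ.* x ℕ.+ d))) (Σ-count p) ⟨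
      Σ p (λ _ → + 1) + Σ p (λ x → χ (x ℕ.* x ℕ.+ d))  ≡⟨ Σ-+ p _ _ ⟨
      Σ p (λ x → + 1 + χ (x ℕ.* x ℕ.+ d))              ≡⟨ Σ-ext p (λ x → roots≡1+χ (x ℕ.* x ℕ.+ d)) ⟨
      Σ p (λ x → Σ p (solution x))                     ≡⟨ #solutions≡k ⟩
      + k                                              ∎)
      where open ≡-Reasoning

    -- 1 + χ a counts the square roots of a, so Σ χ(a) χ(a+d) = Σ (1 + χ a) χ(a+d) = Σ χ(x² + d).
    Σ-χχ+-∤ : Σ p (λ a → χ a * χ (a ℕ.+ d)) ≡ - + 1
    Σ-χχ+-∤ = begin
      Σ p (λ a → χ a * χ (a ℕ.+ d))                                  ≡⟨ ℤP.+-identityˡ _ ⟨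
      + 0 + Σ p (λ a → χ a * χ (a ℕ.+ d))                            ≡⟨ cong (_+ Σ p (λ a → χ a * χ (a ℕ.+ d))) (Σ-χ+c≡0 d) ⟨
      Σ p (λ a → χ (a ℕ.+ d)) + Σ p (λ a → χ a * χ (a ℕ.+ d))        ≡⟨ Σ-+ p _ _ ⟨
      Σ p (λ a → χ (a ℕ.+ d) + χ a * χ (a ℕ.+ d))                    ≡⟨ Σ-ext p (λ a → factor (χ (a ℕ.+ d)) (χ a)) ⟩
      Σ p (λ a → (+ 1 + χ a) * χ (a ℕ.+ d))                          ≡⟨ Σ-ext p (λ a → cong (_* χ (a ℕ.+ d)) (roots≡1+χ a)) ⟨
      Σ p (λ a → roots (a % p) * χ (a ℕ.+ d))                        ≡⟨ Σ-ext p (λ a → Σ-*ʳ p _ _) ⟨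
      Σ p (λ a → Σ p (λ x → 𝟙 (x ℕ.* x % p ℕ.≟ a % p) * χ (a ℕ.+ d)))  ≡⟨ Σ-swap p p _ ⟩
      Σ p (λ x → Σ p (λ a → 𝟙 (x ℕ.* x % p ℕ.≟ a % p) * χ (a ℕ.+ d)))  ≡⟨ Σ-ext p (λ x → trans (Σ-cong p (pick x)) (Σ-δ p (x ℕ.* x % p) (λ a → χ (a ℕ.+ d)) (m%n<n (x ℕ.* x) p))) ⟩
      Σ p (λ x → χ (x ℕ.* x % p ℕ.+ d))                              ≡⟨ Σ-ext p (λ x → periodic-% (periodic-shift χ-periodic d) (x ℕ.* x)) ⟩
      Σ p (λ x → χ (x ℕ.* x ℕ.+ d))                                  ≡⟨ Σ-χ[x²+d]≡-1 ⟩
      - + 1                                                          ∎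
      where
      open ≡-Reasoning
      factor : ∀ X Y → X + Y * X ≡ (+ 1 + Y) * X
      factor = solve-∀
      pick : ∀ x a → a < p → 𝟙 (x ℕ.* x % p ℕ.≟ a % p) * χ (a ℕ.+ d) ≡ χ (a ℕ.+ d) * 𝟙 (x ℕ.* x % p ℕ.≟ a)
      pick x a a<p = trans (ℤP.*-comm _ (χ (a ℕ.+ d))) (cong (λ r → χ (a ℕ.+ d) * 𝟙 (x ℕ.* x % p ℕ.≟ r)) (m<n⇒m%n≡m a<p))

module OddPrime where

  open FiniteSum
  open Signs
  open PeriodicSum

  OddPrime : ℕ → Set
  OddPrime q = Prime q × q ≢ 2

  χ : ℕ → ℕ → ℤ
  χ q n = legendre (+ n) q

  χ-periodic : ∀ {q} → OddPrime q → Periodic q (χ q)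
  χ-periodic {suc k} (q-prime , q≢2) = Legendre.χ-periodic k q-prime q≢2

  legendre-signOrZero : ∀ {q} → OddPrime q → ∀ z → SignOrZero (legendre z q)
  legendre-signOrZero {suc k} (q-prime , q≢2) z = Legendre.symbol-signOrZero k q-prime q≢2 (z ℤ.%ℕ suc k)

  𝟙[coprime]≡χ² : ∀ {q} → OddPrime q → ∀ α → 𝟙 (coprime? α q) ≡ χ q α * χ q α
  𝟙[coprime]≡χ² {suc k} (q-prime , q≢2) = Legendre.𝟙[coprime]≡χ² k q-prime q≢2

  legendre-∣ : ∀ {q} → OddPrime q → ∀ d → q ∣ d → legendre (+ d) q ≡ + 0
  legendre-∣ {suc k} (q-prime , q≢2) = Legendre.χ-∣ k q-prime q≢2

  legendre-neg-∣ : ∀ {q} → OddPrime q → ∀ d → d ≢ 0 → q ∣ d → legendre (- + d) q ≡ + 0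
  legendre-neg-∣ {suc k} (q-prime , q≢2) d d≢0 q∣d =
    trans (sym (Legendre.χ-negate k q-prime q≢2 d d≢0)) (Legendre.χ-negate-∣ k q-prime q≢2 d q∣d)

  Σ-χ²χ+ : ∀ {q} → OddPrime q → ∀ d → Σ q (λ a → χ q a * χ q a * χ q (a ℕ.+ d)) ≡ - legendre (+ d) q
  Σ-χ²χ+ {suc k} (q-prime , q≢2) = Legendre.Σ-χ²χ+ k q-prime q≢2

  Σ-χχ+² : ∀ {q} → OddPrime q → ∀ d → d ≢ 0 →
           Σ q (λ a → χ q a * (χ q (a ℕ.+ d) * χ q (a ℕ.+ d))) ≡ - legendre (- + d) q
  Σ-χχ+² {suc k} (q-prime , q≢2) d d≢0 =
    trans (Legendre.Σ-χχ+² k q-prime q≢2 d) (cong -_ (Legendre.χ-negate k q-prime q≢2 d d≢0))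

  Σ-χχ+-∣ : ∀ {q} → OddPrime q → ∀ d → q ∣ d → Σ q (λ a → χ q a * χ q (a ℕ.+ d)) ≡ + (q ∸ 1)
  Σ-χχ+-∣ {suc k} (q-prime , q≢2) = Legendre.Σ-χχ+-∣ k q-prime q≢2

  Σ-χχ+-∤ : ∀ {q} → OddPrime q → ∀ d → ¬ (q ∣ d) → Σ q (λ a → χ q a * χ q (a ℕ.+ d)) ≡ - + 1
  Σ-χχ+-∤ {suc k} (q-prime , q≢2) d = Legendre.NonDivisor.Σ-χχ+-∤ k q-prime q≢2 d

module Jacobi where

  open ListProduct
  open FiniteSum
  open PeriodicSum
  open OddPrime

  jacobi≡∏ : ∀ z g qs → All Prime qs → g ≡ product qs → jacobi z g ≡ ∏ qs (legendre z)
  jacobi≡∏ z zero    qs primes 0≡qs = contradiction (sym 0≡qs) (ℕ.≢-nonZero⁻¹ (product qs) {{productOfPrimes≢0 primes}})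
  jacobi≡∏ z (suc n) qs primes g≡qs = ∏-↭ (legendre z)
    (factorisationUnique (factorise (suc n)) record { factors = qs ; isFactorisation = g≡qs ; factorsPrime = primes })

  coprime-* : ∀ {a m n} → Coprime a m → Coprime a n → Coprime a (m ℕ.* n)
  coprime-* {m = m} a⊥m a⊥n (c∣a , c∣mn) = a⊥n (c∣a , coprime-divisor c⊥m c∣mn)
    where
    c⊥m : Coprime _ m
    c⊥m (e∣c , e∣m) = a⊥m (∣-trans e∣c c∣a , e∣m)

  coprime-*⁻ : ∀ {a m n} → Coprime a (m ℕ.* n) → Coprime a m × Coprime a n
  coprime-*⁻ {m = m} {n} a⊥mn = (λ (c∣a , c∣m) → a⊥mn (c∣a , ∣-trans c∣m (m∣m*n n)))
                              , (λ (c∣a , c∣n) → a⊥mn (c∣a , ∣-trans c∣n (n∣m*n m)))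

  coprime-∏ : ∀ {d} qs → All Prime qs → All (λ q → ¬ (q ∣ d)) qs → Coprime d (product qs)
  coprime-∏ []       []                 []             = Coprime.sym (Coprime.1-coprimeTo _)
  coprime-∏ (q ∷ qs) (q-prime ∷ primes) (q∤d ∷ ∤d) =
    coprime-* (Coprime.sym (prime∤⇒coprime q-prime q∤d)) (coprime-∏ qs primes ∤d)

  𝟙[coprime-∏]≡∏χ² : ∀ qs → All OddPrime qs → ∀ α → 𝟙 (coprime? α (product qs)) ≡ ∏ qs (λ q → χ q α * χ q α)
  𝟙[coprime-∏]≡∏χ² []       []           α = 𝟙≡1 (coprime? α 1) (Coprime.sym (Coprime.1-coprimeTo α))
  𝟙[coprime-∏]≡∏χ² (q ∷ qs) (q-odd ∷ odd) α = begin
    𝟙 (coprime? α (q ℕ.* product qs))                    ≡⟨ 𝟙-cong (coprime? α _) (coprime? α q ×-dec coprime? α (product qs))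
                                                             coprime-*⁻ (λ (α⊥q , α⊥qs) → coprime-* α⊥q α⊥qs) ⟩
    𝟙 (coprime? α q ×-dec coprime? α (product qs))       ≡⟨ 𝟙-× (coprime? α q) (coprime? α (product qs)) ⟩
    𝟙 (coprime? α q) * 𝟙 (coprime? α (product qs))       ≡⟨ cong₂ _*_ (𝟙[coprime]≡χ² q-odd α) (𝟙[coprime-∏]≡∏χ² qs odd α) ⟩
    χ q α * χ q α * ∏ qs (λ q → χ q α * χ q α)           ∎
    where open ≡-Reasoning

module Count (qs : List ℕ) (odd-primes : All OddPrime.OddPrime qs) (unique : Unique qs) (d : ℕ) (d≢0 : d ≢ 0) where

  open FiniteSum
  open Signs
  open ListProduct
  open PeriodicSum
  open OddPrime
  open Jacobi

  g : ℕ
  g = product qs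

  primes : All Prime qs
  primes = All.map (λ (q-prime , _) → q-prime) odd-primes

  instance
    g≢0 : NonZero g
    g≢0 = productOfPrimes≢0 primes

  term : (ℤ → ℤ → ℤ) → ℕ → ℕ → ℤ
  term c q α = c (χ q α) (χ q (α ℕ.+ d))

  S : (ℤ → ℤ → ℤ) → ℤ
  S c = Σ g (λ k → ∏ qs (λ q → term c q (suc k)))

  S≡∏Σ : ∀ c → S c ≡ ∏ qs (λ q → Σ q (term c q))
  S≡∏Σ c = begin
    Σ g (λ k → ∏ qs (λ q → term c q (suc k)))   ≡⟨ Σ-ext g (λ k → cong (λ α → ∏ qs (λ q → term c q α)) (ℕP.+-comm 1 k)) ⟩
    Σ g (λ k → ∏ qs (λ q → term c q (k ℕ.+ 1))) ≡⟨ Σ-shift g _ (periodic-∏ qs g (term c) periodic (All.tabulate ∈⇒∣product)) 1 ⟩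
    Σ g (λ α → ∏ qs (λ q → term c q α))         ≡⟨ Σ-∏ qs (term c) primes unique periodic ⟩
    ∏ qs (λ q → Σ q (term c q))                 ∎
    where
    open ≡-Reasoning
    periodic : All (λ q → Periodic q (term c q)) qs
    periodic = All.map (λ q-odd α → cong₂ c (χ-periodic q-odd α) (periodic-shift (χ-periodic q-odd) d α)) odd-primes

  J : ℕ → ℤ
  J α = ∏ qs (λ q → χ q α)

  jacobi≡J : ∀ α → jacobi (+ α) g ≡ J α
  jacobi≡J α = jacobi≡∏ (+ α) g qs primes refl

  J-signOrZero : ∀ α → SignOrZero (J α)
  J-signOrZero α = ∏-signOrZero qs _ (All.map (λ q-odd → legendre-signOrZero q-odd (+ α)) odd-primes)

  c₂₂ c₂₁ c₁₂ c₁₁ : ℤ → ℤ → ℤ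
  c₂₂ x y = x * x * (y * y)
  c₂₁ x y = x * x * y
  c₁₂ x y = x * (y * y)
  c₁₁ x y = x * y

  length-φ : + length (φ-set g d) ≡ S c₂₂
  length-φ = begin
    + length (filter both? (map suc (upTo g)))             ≡⟨ cong (λ l → + length (filter both? l)) (ListP.map-upTo suc g) ⟩
    + length (filter both? (applyUpTo suc g))              ≡⟨ length-filter-applyUpTo both? g suc ⟩
    Σ g (λ k → 𝟙 (both? (suc k)))                          ≡⟨ Σ-ext g (λ k → 𝟙-× (coprime? (suc k) g) (coprime? (suc k ℕ.+ d) g)) ⟩
    Σ g (λ k → 𝟙 (coprime? (suc k) g) * 𝟙 (coprime? (suc k ℕ.+ d) g))
                    ≡⟨ Σ-ext g (λ k → cong₂ _*_ (𝟙[coprime-∏]≡∏χ² qs odd-primes (suc k)) (𝟙[coprime-∏]≡∏χ² qs odd-primes (suc k ℕ.+ d))) ⟩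
    Σ g (λ k → ∏ qs (λ q → χ q (suc k) * χ q (suc k)) * ∏ qs (λ q → χ q (suc k ℕ.+ d) * χ q (suc k ℕ.+ d)))
                    ≡⟨ Σ-ext g (λ k → ∏-* qs _ _) ⟩
    S c₂₂                                                  ∎
    where
    open ≡-Reasoning
    both? = λ α → coprime? α g ×-dec coprime? (α ℕ.+ d) g

  4*𝟙[Φ]≡ : ∀ {ε₁ ε₂} → Sign ε₁ → Sign ε₂ → ∀ α →
            + 4 * 𝟙 ((jacobi (+ α) g ℤ.≟ ε₁) ×-dec (jacobi (+ (α ℕ.+ d)) g ℤ.≟ ε₂))
              ≡ ∏ qs (λ q → term c₂₂ q α) + ε₂ * ∏ qs (λ q → term c₂₁ q α)
                + ε₁ * ∏ qs (λ q → term c₁₂ q α) + ε₁ * ε₂ * ∏ qs (λ q → term c₁₁ q α)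
  4*𝟙[Φ]≡ {ε₁} {ε₂} ε₁± ε₂± α = begin
    + 4 * 𝟙 ((jacobi (+ α) g ℤ.≟ ε₁) ×-dec (jacobi (+ β) g ℤ.≟ ε₂))
        ≡⟨ cong₂ (λ x y → + 4 * 𝟙 ((x ℤ.≟ ε₁) ×-dec (y ℤ.≟ ε₂))) (jacobi≡J α) (jacobi≡J β) ⟩
    + 4 * 𝟙 ((J α ℤ.≟ ε₁) ×-dec (J β ℤ.≟ ε₂))
        ≡⟨ 4*𝟙[≟sign×≟sign] (J-signOrZero α) (J-signOrZero β) ε₁± ε₂± ⟩
    (J α * J α + ε₁ * J α) * (J β * J β + ε₂ * J β)
        ≡⟨ expand (J α) (J β) ε₁ ε₂ ⟩
    c₂₂ (J α) (J β) + ε₂ * c₂₁ (J α) (J β) + ε₁ * c₁₂ (J α) (J β) + ε₁ * ε₂ * c₁₁ (J α) (J β)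
        ≡⟨ cong₂ _+_ (cong₂ _+_ (cong₂ _+_ ∏₂₂ (cong (_*_ ε₂) ∏₂₁)) (cong (_*_ ε₁) ∏₁₂)) (cong (_*_ (ε₁ * ε₂)) ∏₁₁) ⟩
    ∏ qs (λ q → term c₂₂ q α) + ε₂ * ∏ qs (λ q → term c₂₁ q α)
      + ε₁ * ∏ qs (λ q → term c₁₂ q α) + ε₁ * ε₂ * ∏ qs (λ q → term c₁₁ q α) ∎
    where
    open ≡-Reasoning
    β = α ℕ.+ d
    expand : ∀ a b e₁ e₂ → (a * a + e₁ * a) * (b * b + e₂ * b)
                         ≡ a * a * (b * b) + e₂ * (a * a * b) + e₁ * (a * (b * b)) + e₁ * e₂ * (a * b)
    expand = solve-∀
    ∏₁₁ : J α * J β ≡ ∏ qs (λ q → term c₁₁ q α)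
    ∏₁₁ = ∏-* qs _ _
    ∏₂₁ : J α * J α * J β ≡ ∏ qs (λ q → term c₂₁ q α)
    ∏₂₁ = trans (cong (_* J β) (∏-* qs _ _)) (∏-* qs _ _)
    ∏₁₂ : J α * (J β * J β) ≡ ∏ qs (λ q → term c₁₂ q α)
    ∏₁₂ = trans (cong (_*_ (J α)) (∏-* qs _ _)) (∏-* qs _ _)
    ∏₂₂ : J α * J α * (J β * J β) ≡ ∏ qs (λ q → term c₂₂ q α)
    ∏₂₂ = trans (cong₂ _*_ (∏-* qs _ _) (∏-* qs _ _)) (∏-* qs _ _)

  4*length-Φ≡S : ∀ {ε₁ ε₂} → Sign ε₁ → Sign ε₂ →
               + 4 * + length (Φ-set ε₁ ε₂ g d) ≡ S c₂₂ + ε₂ * S c₂₁ + ε₁ * S c₁₂ + ε₁ * ε₂ * S c₁₁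
  4*length-Φ≡S {ε₁} {ε₂} ε₁± ε₂± = begin
    + 4 * + length (filter Φ? (map suc (upTo g)))     ≡⟨ cong (λ l → + 4 * + length (filter Φ? l)) (ListP.map-upTo suc g) ⟩
    + 4 * + length (filter Φ? (applyUpTo suc g))      ≡⟨ cong (_*_ (+ 4)) (length-filter-applyUpTo Φ? g suc) ⟩
    + 4 * Σ g (λ k → 𝟙 (Φ? (suc k)))                  ≡⟨ Σ-*ˡ g (+ 4) _ ⟨
    Σ g (λ k → + 4 * 𝟙 (Φ? (suc k)))                  ≡⟨ Σ-ext g (λ k → 4*𝟙[Φ]≡ ε₁± ε₂± (suc k)) ⟩
    Σ g (λ k → A k + ε₂ * B k + ε₁ * C k + ε₁ * ε₂ * D k)
                      ≡⟨ trans (Σ-+ g _ _) (cong₂ _+_ (trans (Σ-+ g _ _) (cong₂ _+_ (trans (Σ-+ g _ _)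
                           (cong (_+_ (S c₂₂)) (Σ-*ˡ g ε₂ B))) (Σ-*ˡ g ε₁ C))) (Σ-*ˡ g (ε₁ * ε₂) D)) ⟩
    S c₂₂ + ε₂ * S c₂₁ + ε₁ * S c₁₂ + ε₁ * ε₂ * S c₁₁ ∎
    where
    open ≡-Reasoning
    Φ? = λ α → (jacobi (+ α) g ℤ.≟ ε₁) ×-dec (jacobi (+ (α ℕ.+ d)) g ℤ.≟ ε₂)
    A B C D : ℕ → ℤ
    A k = ∏ qs (λ q → term c₂₂ q (suc k))
    B k = ∏ qs (λ q → term c₂₁ q (suc k))
    C k = ∏ qs (λ q → term c₁₂ q (suc k))
    D k = ∏ qs (λ q → term c₁₁ q (suc k))

  S₂₁≡ : S c₂₁ ≡ (- + 1) ^ length qs * jacobi (+ d) g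
  S₂₁≡ = begin
    S c₂₁                                          ≡⟨ S≡∏Σ c₂₁ ⟩
    ∏ qs (λ q → Σ q (term c₂₁ q))                  ≡⟨ ∏-cong qs _ _ odd-primes (λ q q-odd → Σ-χ²χ+ q-odd d) ⟩
    ∏ qs (λ q → - legendre (+ d) q)                ≡⟨ ∏-neg qs _ ⟩
    (- + 1) ^ length qs * ∏ qs (legendre (+ d))    ≡⟨ cong (_*_ ((- + 1) ^ length qs)) (jacobi≡∏ (+ d) g qs primes refl) ⟨
    (- + 1) ^ length qs * jacobi (+ d) g           ∎
    where open ≡-Reasoning

  S₁₂≡ : S c₁₂ ≡ (- + 1) ^ length qs * jacobi (- + d) g
  S₁₂≡ = begin
    S c₁₂                                          ≡⟨ S≡∏Σ c₁₂ ⟩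
    ∏ qs (λ q → Σ q (term c₁₂ q))                  ≡⟨ ∏-cong qs _ _ odd-primes (λ q q-odd → Σ-χχ+² q-odd d d≢0) ⟩
    ∏ qs (λ q → - legendre (- + d) q)              ≡⟨ ∏-neg qs _ ⟩
    (- + 1) ^ length qs * ∏ qs (legendre (- + d))  ≡⟨ cong (_*_ ((- + 1) ^ length qs)) (jacobi≡∏ (- + d) g qs primes refl) ⟨
    (- + 1) ^ length qs * jacobi (- + d) g         ∎
    where open ≡-Reasoning

  ∏Σ₁₁≡ : ∀ ps → All OddPrime ps →
          ∏ ps (λ q → Σ q (term c₁₁ q))
            ≡ (- + 1) ^ (length ps ∸ length (filter (_∣? d) ps)) * + product (map (λ q → q ∸ 1) (filter (_∣? d) ps))
  ∏Σ₁₁≡ []       []              = refl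
  ∏Σ₁₁≡ (q ∷ ps) (q-odd ∷ odd) with q ∣? d
  ... | yes q∣d = trans (cong₂ _*_ (Σ-χχ+-∣ q-odd d q∣d) (∏Σ₁₁≡ ps odd))
                        (trans (swap-front (+ (q ∸ 1)) sign P) (cong (_*_ sign) (sym (ℤP.pos-* (q ∸ 1) _))))
    where
    sign = (- + 1) ^ (length ps ∸ length (filter (_∣? d) ps))
    P = + product (map (λ q → q ∸ 1) (filter (_∣? d) ps))
    swap-front : ∀ a s r → a * (s * r) ≡ s * (a * r)
    swap-front = solve-∀
  ... | no q∤d  = trans (cong₂ _*_ (Σ-χχ+-∤ q-odd d q∤d) (∏Σ₁₁≡ ps odd))
                        (trans (assoc (- + 1) sign P)
                               (cong (λ n → (- + 1) ^ n * P) (sym (ℕP.+-∸-assoc 1 (ListP.length-filter (_∣? d) ps)))))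
    where
    sign = (- + 1) ^ (length ps ∸ length (filter (_∣? d) ps))
    P = + product (map (λ q → q ∸ 1) (filter (_∣? d) ps))
    assoc : ∀ a s r → a * (s * r) ≡ a * s * r
    assoc = solve-∀

  S₁₁≡ : S c₁₁ ≡ (- + 1) ^ (length qs ∸ length (filter (_∣? d) qs)) * + product (map (λ q → q ∸ 1) (filter (_∣? d) qs))
  S₁₁≡ = trans (S≡∏Σ c₁₁) (∏Σ₁₁≡ qs odd-primes)

  gcd≡1⇒∤ : gcd g d ≡ 1 → All (λ q → ¬ (q ∣ d)) qs
  gcd≡1⇒∤ gcd≡1 = All.zipWith (λ (q-prime , q∣g) q∣d → ¬prime[1] (subst Prime (∣1⇒≡1 (subst (_ ∣_) gcd≡1 (gcd-greatest q∣g q∣d))) q-prime))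
                              (primes , All.tabulate ∈⇒∣product)

  gcd≢1⇒jacobi≡0 : gcd g d ≢ 1 → jacobi (+ d) g ≡ + 0 × jacobi (- + d) g ≡ + 0
  gcd≢1⇒jacobi≡0 gcd≢1 with any? (_∣? d) qs
  ... | no ∄q∣d = contradiction (Coprime.coprime⇒gcd≡1 (Coprime.sym (coprime-∏ qs primes (¬Any⇒All¬ qs ∄q∣d)))) gcd≢1
  ... | yes ∃q∣d with find ∃q∣d
  ...   | q , q∈qs , q∣d =
    trans (jacobi≡∏ (+ d) g qs primes refl) (∏-zero qs _ q∈qs (legendre-∣ q-odd d q∣d)) ,
    trans (jacobi≡∏ (- + d) g qs primes refl) (∏-zero qs _ q∈qs (legendre-neg-∣ q-odd d d≢0 q∣d))
    where q-odd = All.lookup odd-primes q∈qs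

  4*length-Φ≡jacobi : ∀ {ε₁ ε₂} → Sign ε₁ → Sign ε₂ →
    + 4 * + length (Φ-set ε₁ ε₂ g d)
      ≡ + length (φ-set g d) + ε₂ * ((- + 1) ^ length qs * jacobi (+ d) g) + ε₁ * ((- + 1) ^ length qs * jacobi (- + d) g)
        + ε₁ * ε₂ * ((- + 1) ^ (length qs ∸ length (filter (_∣? d) qs)) * + product (map (λ q → q ∸ 1) (filter (_∣? d) qs)))
  4*length-Φ≡jacobi {ε₁} {ε₂} ε₁± ε₂± = trans (4*length-Φ≡S ε₁± ε₂±)
    (cong₂ _+_ (cong₂ _+_ (cong₂ _+_ (sym length-φ) (cong (_*_ ε₂) S₂₁≡)) (cong (_*_ ε₁) S₁₂≡)) (cong (_*_ (ε₁ * ε₂)) S₁₁≡))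

  coprime-formula : ∀ {ε₁ ε₂} → Sign ε₁ → Sign ε₂ → gcd g d ≡ 1 →
    + 4 * + length (Φ-set ε₁ ε₂ g d) ≡ + length (φ-set g d) + (- + 1) ^ length qs * (jacobi (- + d) g * ε₁ + jacobi (+ d) g * ε₂ + ε₁ * ε₂)
  coprime-formula {ε₁} {ε₂} ε₁± ε₂± gcd≡1 = begin
    + 4 * + length (Φ-set ε₁ ε₂ g d)                             ≡⟨ 4*length-Φ≡jacobi ε₁± ε₂± ⟩
    φ + ε₂ * (s * jd) + ε₁ * (s * j-d) + ε₁ * ε₂ * sign-product (filter (_∣? d) qs)
                                                                 ≡⟨ cong (λ ds → φ + ε₂ * (s * jd) + ε₁ * (s * j-d) + ε₁ * ε₂ * sign-product ds)
                                                                         (ListP.filter-none (_∣? d) (gcd≡1⇒∤ gcd≡1)) ⟩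
    φ + ε₂ * (s * jd) + ε₁ * (s * j-d) + ε₁ * ε₂ * (s * + 1)     ≡⟨ regroup φ s jd j-d ε₁ ε₂ ⟩
    φ + s * (j-d * ε₁ + jd * ε₂ + ε₁ * ε₂)                       ∎
    where
    open ≡-Reasoning
    φ = + length (φ-set g d)
    s = (- + 1) ^ length qs
    jd = jacobi (+ d) g
    j-d = jacobi (- + d) g
    sign-product : List ℕ → ℤ
    sign-product ds = (- + 1) ^ (length qs ∸ length ds) * + product (map (λ q → q ∸ 1) ds)
    regroup : ∀ φ s jd j-d e₁ e₂ → φ + e₂ * (s * jd) + e₁ * (s * j-d) + e₁ * e₂ * (s * + 1) ≡ φ + s * (j-d * e₁ + jd * e₂ + e₁ * e₂)
    regroup = solve-∀

  non-coprime-formula : ∀ {ε₁ ε₂} → Sign ε₁ → Sign ε₂ → gcd g d ≢ 1 →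
    + 4 * + length (Φ-set ε₁ ε₂ g d)
      ≡ + length (φ-set g d)
        + (- + 1) ^ (length qs ∸ length (filter (_∣? d) qs)) * ε₁ * ε₂ * + product (map (λ q → q ∸ 1) (filter (_∣? d) qs))
  non-coprime-formula {ε₁} {ε₂} ε₁± ε₂± gcd≢1 with gcd≢1⇒jacobi≡0 gcd≢1
  ... | jd≡0 , j-d≡0 = begin
    + 4 * + length (Φ-set ε₁ ε₂ g d)                                          ≡⟨ 4*length-Φ≡jacobi ε₁± ε₂± ⟩
    φ + ε₂ * (s * jacobi (+ d) g) + ε₁ * (s * jacobi (- + d) g) + ε₁ * ε₂ * (t * P)
                                                                              ≡⟨ cong₂ (λ x y → φ + ε₂ * (s * x) + ε₁ * (s * y) + ε₁ * ε₂ * (t * P)) jd≡0 j-d≡0 ⟩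
    φ + ε₂ * (s * + 0) + ε₁ * (s * + 0) + ε₁ * ε₂ * (t * P)                   ≡⟨ regroup φ s t P ε₁ ε₂ ⟩
    φ + t * ε₁ * ε₂ * P                                                       ∎
    where
    open ≡-Reasoning
    φ = + length (φ-set g d)
    s = (- + 1) ^ length qs
    t = (- + 1) ^ (length qs ∸ length (filter (_∣? d) qs))
    P = + product (map (λ q → q ∸ 1) (filter (_∣? d) qs))
    regroup : ∀ φ s t P e₁ e₂ → φ + e₂ * (s * + 0) + e₁ * (s * + 0) + e₁ * e₂ * (t * P) ≡ φ + t * e₁ * e₂ * P
    regroup = solve-∀

lemma1 : (g d : ℕ) (qs : List ℕ) (ε₁ ε₂ : ℤ) →
  ¬ (2 ∣ g) →
  All Prime qs → Unique qs → g ≡ product qs →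
  2 ∣ d → d ≢ 0 →
  (ε₁ ≡ + 1 ⊎ ε₁ ≡ - + 1) → (ε₂ ≡ + 1 ⊎ ε₂ ≡ - + 1) →
  (gcd g d ≡ 1 →
    + 4 * + length (Φ-set ε₁ ε₂ g d)
      ≡ + length (φ-set g d)
        + (- + 1) ^ length qs
          * (jacobi (- + d) g * ε₁ + jacobi (+ d) g * ε₂ + ε₁ * ε₂))
  × (gcd g d ≢ 1 →
    + 4 * + length (Φ-set ε₁ ε₂ g d)
      ≡ + length (φ-set g d)
        + (- + 1) ^ (length qs ∸ length (filter (_∣? d) qs))
          * ε₁ * ε₂
          * + product (map (λ q → q ∸ 1) (filter (_∣? d) qs)))
lemma1 .(product qs) d qs ε₁ ε₂ 2∤g primes unique refl _ d≢0 ε₁± ε₂± =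
  coprime-formula ε₁± ε₂± , non-coprime-formula ε₁± ε₂±
  where
  odd-primes : All OddPrime.OddPrime qs
  odd-primes = All.zipWith (λ (q-prime , q∣g) → q-prime , λ q≡2 → 2∤g (subst (_∣ product qs) q≡2 q∣g))
                           (primes , All.tabulate ∈⇒∣product)
  open Count qs odd-primes unique d d≢0 using (coprime-formula; non-coprime-formula)
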